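{- Let $k\le n\le N$ and $y_1,\dots,y_k\in\mathbb{F}^N$. Then, as functions of $x\in\mathbb{F}^N$, $$(S_n)_{y_1\dots y_k}(x)=\sum_{m=0}^{n-k}\ \sum_{\substack{\ell_1,\dots,\ell_k\ge1\\ \ell_1+\dots+\ell_k=n-m}}\mathcal{H}\big(x^{(m)},y_1^{(\ell_1)},\dots,y_k^{(\ell_k)}\big).$$
   Context: $\mathbb{F}=\mathbb{F}_p$, $p$ prime. $S_n(x)=\sum_{S\subseteq[N],|S|=n}\prod_{i\in S}x_i$; $f_y(x)=f(x+y)-f(x)$ and $f_{y_1\dots y_k}=(f_{y_1\dots y_{k-1}})_{y_k}$. For vectors $r_1,\dots,r_s\in\mathbb{F}^N$ and integers $\ell_1,\dots,\ell_s\ge0$ with $\sum\ell_t=n$, let $M$ be the $n\times N$ matrix consisting of $\ell_1$ rows equal to $r_1$, followed by $\ell_2$ rows equal to $r_2$, etc.; let $\lambda_t\subseteq[n]$ be the (consecutive) set of row indices of the $t$-th block. Then $\mathcal{H}(r_1^{(\ell_1)},\dots,r_s^{(\ell_s)})=\sum_\rho\prod_{i=1}^n M_{i,\rho(i)}$, where $\rho$ ranges over injective maps $[n]\to[N]$ that are increasing on each block $\lambda_t$ (i.e. $\rho(i)<\rho(i')$ whenever $i<i'$ lie in the same $\lambda_t$). A block with $\ell_t=0$ (e.g. $x^{(0)}$) contributes no rows. -}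

module Defs where

open import Data.Bool using (Bool; true; false; if_then_else_)
open import Data.Nat as ℕ using (ℕ; zero; suc; _∸_; NonZero)
open import Data.Nat.DivMod using (_mod_)
open import Data.Fin as Fin using (Fin; toℕ)
open import Data.Fin.Properties using (all?) renaming (_≟_ to _≟ᶠ_; _<?_ to _<ᶠ?_)
open import Data.Fin.Subset using (Subset; ∣_∣)
open import Data.List as List using (List; []; _∷_; _++_; map; foldr; filter; concatMap; replicate; length; lookup; allFin; upTo)
open import Data.Vec as Vec using (Vec)
open import Data.Vec.Relation.Unary.All as VAll using (All)
open import Data.Product using (_×_; _,_; proj₁; proj₂)
open import Relation.Binary.PropositionalEquality using (_≡_)
open import Relation.Nullary.Decidable using (Dec; _×-dec_; _→-dec_)

𝔽 : ℕ → Set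
𝔽 p = Fin p

module _ {p : ℕ} .{{_ : NonZero p}} where

  infixl 6 _+F_ _-F_
  infixl 7 _*F_

  0F 1F : 𝔽 p
  0F = 0 mod p
  1F = 1 mod p

  _+F_ _*F_ _-F_ : 𝔽 p → 𝔽 p → 𝔽 p
  a +F b = (toℕ a ℕ.+ toℕ b) mod p
  a *F b = (toℕ a ℕ.* toℕ b) mod p

  negF : 𝔽 p → 𝔽 p
  negF a = (p ∸ toℕ a) mod p

  a -F b = a +F negF b

  sumF prodF : List (𝔽 p) → 𝔽 p
  sumF  = foldr _+F_ 0F
  prodF = foldr _*F_ 1F

𝔽^ : ℕ → ℕ → Set
𝔽^ p N = Fin N → 𝔽 p

module _ {p : ℕ} .{{_ : NonZero p}} {N : ℕ} where

  _⊕_ : 𝔽^ p N → 𝔽^ p N → 𝔽^ p N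
  (x ⊕ y) i = x i +F y i

  Δ : 𝔽^ p N → (𝔽^ p N → 𝔽 p) → (𝔽^ p N → 𝔽 p)
  Δ y f x = f (x ⊕ y) -F f x

  Δs : ∀ {k} → Vec (𝔽^ p N) k → (𝔽^ p N → 𝔽 p) → (𝔽^ p N → 𝔽 p)
  Δs Vec.[]       f = f
  Δs (y Vec.∷ ys) f = Δs ys (Δ y f)

allSubsets : ∀ N → List (Subset N)
allSubsets zero    = Vec.[] ∷ []
allSubsets (suc N) = map (true Vec.∷_) (allSubsets N) ++ map (false Vec.∷_) (allSubsets N)

module _ {p : ℕ} .{{_ : NonZero p}} {N : ℕ} where

  prodOver : Subset N → 𝔽^ p N → 𝔽 p
  prodOver S x = prodF (map (λ i → if Vec.lookup S i then x i else 1F) (allFin N))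

  S : ℕ → 𝔽^ p N → 𝔽 p
  S n x = sumF (map (λ T → prodOver T x) (filter (λ T → ∣ T ∣ ℕ.≟ n) (allSubsets N)))

-- rows of M, each tagged with the index of its block
rowsFrom : {A : Set} → ℕ → List (A × ℕ) → List (A × ℕ)
rowsFrom t []             = []
rowsFrom t ((r , ℓ) ∷ bs) = replicate ℓ (r , t) ++ rowsFrom (suc t) bs

rows : {A : Set} → List (A × ℕ) → List (A × ℕ)
rows = rowsFrom 0

allFuns : ∀ n N → List (Fin n → Fin N)
allFuns zero    N = (λ ()) ∷ []
allFuns (suc n) N = concatMap (λ j → map (λ f → cons j f) (allFuns n N)) (allFin N)
  where
  cons : ∀ {n N} → Fin N → (Fin n → Fin N) → Fin (suc n) → Fin N
  cons j f Fin.zero    = j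
  cons j f (Fin.suc i) = f i

module _ {p : ℕ} .{{_ : NonZero p}} {N : ℕ} (bs : List (𝔽^ p N × ℕ)) where

  nRows : ℕ
  nRows = length (rows bs)

  M : Fin nRows → Fin N → 𝔽 p
  M i j = proj₁ (lookup (rows bs) i) j

  block : Fin nRows → ℕ
  block i = proj₂ (lookup (rows bs) i)

  Admissible : (Fin nRows → Fin N) → Set
  Admissible ρ =
    (∀ i i' → ρ i ≡ ρ i' → i ≡ i') ×
    (∀ i i' → i Fin.< i' → block i ≡ block i' → ρ i Fin.< ρ i')

  admissible? : (ρ : Fin nRows → Fin N) → Dec (Admissible ρ)
  admissible? ρ =
    all? (λ i → all? (λ i' → (ρ i ≟ᶠ ρ i') →-dec (i ≟ᶠ i'))) ×-dec
    all? (λ i → all? (λ i' → (i <ᶠ? i') →-dec ((block i ℕ.≟ block i') →-dec (ρ i <ᶠ? ρ i'))))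

  ℋ : 𝔽 p
  ℋ = sumF (map (λ ρ → prodF (map (λ i → M i (ρ i)) (allFin nRows)))
                (filter admissible? (allFuns nRows N)))

boundedVecs : ∀ k → ℕ → List (Vec ℕ k)
boundedVecs zero    t = Vec.[] ∷ []
boundedVecs (suc k) t = concatMap (λ a → map (a Vec.∷_) (boundedVecs k t)) (upTo (suc t))

compositions : ∀ k → ℕ → List (Vec ℕ k)
compositions k t =
  filter (λ ℓs → VAll.all? (λ a → 1 ℕ.≤? a) ℓs ×-dec (Vec.sum ℓs ℕ.≟ t)) (boundedVecs k t)

RHS : ∀ {p} .{{_ : NonZero p}} {N k} → ℕ → Vec (𝔽^ p N) k → 𝔽^ p N → 𝔽 p
RHS {k = k} n ys x =
  sumF (map (λ m →
    sumF (map (λ ℓs → ℋ ((x , m) ∷ Vec.toList (Vec.zipWith _,_ ys ℓs)))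
              (compositions k (n ∸ m))))
    (upTo (suc (n ∸ k))))

module Submission where

-- Idea.  S_n(x) = ℋ(x^(n)), and ℋ satisfies a column recursion: either no
-- row of M uses column 0, or column 0 is used by the first row r of some
-- nonempty block, which contributes r[0].  From it follows, by induction on
-- the number of columns, the shift identity
--     ℋ((x+y)^(m), B) = Σ_{j=0}^{m} ℋ(x^(m-j), B, y^(j)),
-- so a derivative in direction y moves ℓ ≥ 1 rows from the x-block into a new
-- y-block; iterating over y₁, …, y_k gives the theorem, up to reindexing the
-- resulting sum as a sum over remainders m and compositions ℓ₁ + … + ℓ_k.

open import Defs
open import Algebra.Bundles using (CommutativeRing)
open import Algebra.Core using (Op₁; Op₂)
open import Algebra.Structures using (IsCommutativeRing)
open import Data.Fin as Fin using (Fin; toℕ)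
open import Data.Fin.Properties using (toℕ-fromℕ<; toℕ-injective; toℕ<n; all?; <-asym; <-cmp; ¬∀⟶∃¬; suc-injective)
  renaming (_≟_ to _≟ᶠ_; _<?_ to _<ᶠ?_)
open import Data.Nat as ℕ using (ℕ; zero; suc; _∸_; _%_; _≤_; NonZero)
open import Data.Nat.Primality using (Prime)
open import Data.Nat.DivMod using (_mod_; %-distribˡ-+; %-distribˡ-*; m<n⇒m%n≡m; [m+n]%n≡m%n)
import Data.Nat.Properties as ℕP
open import Data.Bool using (true; false; if_then_else_)
open import Data.Fin.Subset using (Subset; ∣_∣)
open import Data.List as List using (List; []; _∷_; _++_; map; foldr; filter; concatMap; allFin; upTo; length)
open import Data.List.Properties using (map-++; map-tabulate; map-applyUpTo; tabulate-lookup; length-map; map-∘; map-id; map-replicate;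
  filter-all; filter-reject; filter-idem; ++-assoc; ++-identityʳ)
open import Data.Product using (_×_; _,_; proj₁; proj₂)
open import Data.List.Membership.Propositional using (_∈_)
open import Data.List.Membership.Propositional.Properties using (∈-allFin)
open import Data.List.Relation.Unary.Any using (here; there)
open import Data.List.Relation.Unary.All as All using (All; []; _∷_)
open import Data.List.Relation.Unary.All.Properties using (++⁺; map⁺; filter⁺; replicate⁺)
open import Data.Vec as Vec using (Vec)
import Data.Vec.Relation.Unary.All as VAll
open import Function using (_∘_)
open import Data.Empty using (⊥-elim)
open import Data.Sum using (_⊎_; inj₁; inj₂)
open import Relation.Binary.Definitions using (tri<; tri≈; tri>)
open import Relation.Nullary using (Dec; does; yes; no; _because_; ¬_; ¬?; invert)
open import Relation.Nullary.Decidable using (_×-dec_; _→-dec_; _⊎-dec_; dec-true; dec-false; decidable-stable)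
open import Relation.Unary using (Pred; Decidable)
open import Level using (Level; 0ℓ)
open import Relation.Binary.PropositionalEquality hiding ([_])
open ≡-Reasoning

-- The integers modulo p form a commutative ring: reduction modulo p is a
-- surjective map [_] from ℕ that turns + and * into +F and *F, so every
-- semiring law of ℕ transfers; negation is p ∸ a.
module _ {p : ℕ} .{{_ : NonZero p}} where

  [_] : ℕ → 𝔽 p
  [ n ] = n mod p

  toℕ-[] : ∀ n → toℕ [ n ] ≡ n % p
  toℕ-[] n = toℕ-fromℕ< _

  [toℕ] : ∀ (a : 𝔽 p) → [ toℕ a ] ≡ a
  [toℕ] a = toℕ-injective (trans (toℕ-[] (toℕ a)) (m<n⇒m%n≡m (toℕ<n a)))

  []-+ : ∀ m n → [ m ] +F [ n ] ≡ [ m ℕ.+ n ]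
  []-+ m n = toℕ-injective (begin
    toℕ ([ m ] +F [ n ])               ≡⟨ toℕ-[] _ ⟩
    (toℕ [ m ] ℕ.+ toℕ [ n ]) % p      ≡⟨ cong₂ (λ a b → (a ℕ.+ b) % p) (toℕ-[] m) (toℕ-[] n) ⟩
    (m % p ℕ.+ n % p) % p              ≡⟨ %-distribˡ-+ m n p ⟨
    (m ℕ.+ n) % p                      ≡⟨ toℕ-[] _ ⟨
    toℕ [ m ℕ.+ n ]                    ∎)

  []-* : ∀ m n → [ m ] *F [ n ] ≡ [ m ℕ.* n ]
  []-* m n = toℕ-injective (begin
    toℕ ([ m ] *F [ n ])               ≡⟨ toℕ-[] _ ⟩
    (toℕ [ m ] ℕ.* toℕ [ n ]) % p      ≡⟨ cong₂ (λ a b → (a ℕ.* b) % p) (toℕ-[] m) (toℕ-[] n) ⟩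
    (m % p ℕ.* (n % p)) % p            ≡⟨ %-distribˡ-* m n p ⟨
    (m ℕ.* n) % p                      ≡⟨ toℕ-[] _ ⟨
    toℕ [ m ℕ.* n ]                    ∎)

  on-residues₁ : (P : 𝔽 p → Set) → (∀ m → P [ m ]) → ∀ a → P a
  on-residues₁ P h a = subst P ([toℕ] a) (h (toℕ a))

  on-residues₃ : (P : 𝔽 p → 𝔽 p → 𝔽 p → Set) → (∀ m n k → P [ m ] [ n ] [ k ]) → ∀ a b c → P a b c
  on-residues₃ P h a b c =
    on-residues₁ (λ c → P a b c) (λ k →
    on-residues₁ (λ b → P a b [ k ]) (λ n →
    on-residues₁ (λ a → P a [ n ] [ k ]) (λ m → h m n k) a) b) c

  +F-assoc : ∀ a b c → (a +F b) +F c ≡ a +F (b +F c)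
  +F-assoc = on-residues₃ _ λ m n k → begin
    ([ m ] +F [ n ]) +F [ k ]   ≡⟨ cong (_+F [ k ]) ([]-+ m n) ⟩
    [ m ℕ.+ n ] +F [ k ]        ≡⟨ []-+ _ k ⟩
    [ m ℕ.+ n ℕ.+ k ]           ≡⟨ cong [_] (ℕP.+-assoc m n k) ⟩
    [ m ℕ.+ (n ℕ.+ k) ]         ≡⟨ []-+ m _ ⟨
    [ m ] +F [ n ℕ.+ k ]        ≡⟨ cong ([ m ] +F_) ([]-+ n k) ⟨
    [ m ] +F ([ n ] +F [ k ])   ∎

  *F-assoc : ∀ a b c → (a *F b) *F c ≡ a *F (b *F c)
  *F-assoc = on-residues₃ _ λ m n k → begin
    ([ m ] *F [ n ]) *F [ k ]   ≡⟨ cong (_*F [ k ]) ([]-* m n) ⟩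
    [ m ℕ.* n ] *F [ k ]        ≡⟨ []-* _ k ⟩
    [ m ℕ.* n ℕ.* k ]           ≡⟨ cong [_] (ℕP.*-assoc m n k) ⟩
    [ m ℕ.* (n ℕ.* k) ]         ≡⟨ []-* m _ ⟨
    [ m ] *F [ n ℕ.* k ]        ≡⟨ cong ([ m ] *F_) ([]-* n k) ⟨
    [ m ] *F ([ n ] *F [ k ])   ∎

  +F-comm : ∀ a b → a +F b ≡ b +F a
  +F-comm a b = cong [_] (ℕP.+-comm (toℕ a) (toℕ b))

  *F-comm : ∀ a b → a *F b ≡ b *F a
  *F-comm a b = cong [_] (ℕP.*-comm (toℕ a) (toℕ b))

  +F-identityˡ : ∀ a → 0F +F a ≡ a
  +F-identityˡ = on-residues₁ _ λ m → []-+ 0 m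

  *F-identityˡ : ∀ a → 1F *F a ≡ a
  *F-identityˡ = on-residues₁ _ λ m → trans ([]-* 1 m) (cong [_] (ℕP.*-identityˡ m))

  *F-distribʳ : ∀ a b c → (b +F c) *F a ≡ (b *F a) +F (c *F a)
  *F-distribʳ = on-residues₃ _ λ m n k → begin
    ([ n ] +F [ k ]) *F [ m ]          ≡⟨ cong (_*F [ m ]) ([]-+ n k) ⟩
    [ n ℕ.+ k ] *F [ m ]               ≡⟨ []-* _ m ⟩
    [ (n ℕ.+ k) ℕ.* m ]                ≡⟨ cong [_] (ℕP.*-distribʳ-+ m n k) ⟩
    [ n ℕ.* m ℕ.+ k ℕ.* m ]            ≡⟨ []-+ _ _ ⟨
    [ n ℕ.* m ] +F [ k ℕ.* m ]         ≡⟨ cong₂ _+F_ ([]-* n m) ([]-* k m) ⟨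
    ([ n ] *F [ m ]) +F ([ k ] *F [ m ]) ∎

  +F-inverseʳ : ∀ a → a +F negF a ≡ 0F
  +F-inverseʳ a = begin
    a +F negF a                      ≡⟨ cong (_+F negF a) ([toℕ] a) ⟨
    [ toℕ a ] +F [ p ℕ.∸ toℕ a ]     ≡⟨ []-+ (toℕ a) _ ⟩
    [ toℕ a ℕ.+ (p ℕ.∸ toℕ a) ]      ≡⟨ cong [_] (ℕP.m+[n∸m]≡n (ℕP.<⇒≤ (toℕ<n a))) ⟩
    [ p ]                            ≡⟨ toℕ-injective (trans (toℕ-[] p) (trans ([m+n]%n≡m%n 0 p) (sym (toℕ-[] 0)))) ⟩
    0F                               ∎

  𝔽-isCommutativeRing : IsCommutativeRing _≡_ _+F_ _*F_ negF 0F 1F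
  𝔽-isCommutativeRing = record
    { isRing = record
      { +-isAbelianGroup = record
        { isGroup = record
          { isMonoid = record
            { isSemigroup = record
              { isMagma = record { isEquivalence = isEquivalence ; ∙-cong = cong₂ _+F_ }
              ; assoc = +F-assoc }
            ; identity = +F-identityˡ , λ a → trans (+F-comm a 0F) (+F-identityˡ a) }
          ; inverse = (λ a → trans (+F-comm (negF a) a) (+F-inverseʳ a)) , +F-inverseʳ
          ; ⁻¹-cong = cong negF }
        ; comm = +F-comm }
      ; *-cong = cong₂ _*F_
      ; *-assoc = *F-assoc
      ; *-identity = *F-identityˡ , λ a → trans (*F-comm a 1F) (*F-identityˡ a)
      ; distrib = (λ a b c → begin
          a *F (b +F c)          ≡⟨ *F-comm a _ ⟩
          (b +F c) *F a          ≡⟨ *F-distribʳ a b c ⟩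
          b *F a +F c *F a       ≡⟨ cong₂ _+F_ (*F-comm b a) (*F-comm c a) ⟩
          a *F b +F a *F c       ∎)
        , *F-distribʳ }
    ; *-comm = *F-comm }


filter-map : {A B : Set} {ℓ : Level} {P : Pred B ℓ} (P? : Decidable P) (f : A → B) (xs : List A) →
             filter P? (map f xs) ≡ map f (filter (P? ∘ f) xs)
filter-map P? f []       = refl
filter-map P? f (x ∷ xs) with does (P? (f x))
... | true  = cong (f x ∷_) (filter-map P? f xs)
... | false = filter-map P? f xs

module FiniteSums {A : Set} {_+_ _*_ : Op₂ A} {neg : Op₁ A} {0# 1# : A}
                  (ring : IsCommutativeRing _≡_ _+_ _*_ neg 0# 1#) where

  open IsCommutativeRing ring public
    using (+-assoc; +-comm; +-identityˡ; +-identityʳ; -‿inverseʳ; *-identityˡ; zeroˡ; zeroʳ; distribˡ; distribʳ)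

  commutativeRing : CommutativeRing 0ℓ 0ℓ
  commutativeRing = record { isCommutativeRing = ring }

  open import Algebra.Properties.CommutativeSemigroup
    (CommutativeRing.+-commutativeSemigroup commutativeRing) public using (interchange)
    renaming (x∙yz≈y∙xz to x∙yz≈y∙xz⁺)
  open import Algebra.Properties.CommutativeSemigroup
    (CommutativeRing.*-commutativeSemigroup commutativeRing) public using (x∙yz≈y∙xz)
  open import Algebra.Properties.Group (CommutativeRing.+-group commutativeRing) using (inverseʳ-unique)
  open import Algebra.Properties.AbelianGroup (CommutativeRing.+-abelianGroup commutativeRing) public using (xyx⁻¹≈y)

  ∑ : {I : Set} → List I → (I → A) → A
  ∑ L f = foldr _+_ 0# (map f L)

  ∏ : {I : Set} → List I → (I → A) → A
  ∏ L f = foldr _*_ 1# (map f L)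

  ∑< : ℕ → (ℕ → A) → A
  ∑< n = ∑ (upTo n)

  private variable
    I I′ : Set
    P Q : Set

  when : {ℓ : Level} {P : Set ℓ} → Dec P → A → A
  when d x = if does d then x else 0#

  when-⇔ : (P? : Dec P) (Q? : Dec Q) {x y : A} → (P → Q) → (Q → P) → x ≡ y → when P? x ≡ when Q? y
  when-⇔ (true  because _)    (true  because _)    _   _   x≡y = x≡y
  when-⇔ (true  because [p])  (false because [¬q]) P→Q _   _   = ⊥-elim (invert [¬q] (P→Q (invert [p])))
  when-⇔ (false because [¬p]) (true  because [q])  _   Q→P _   = ⊥-elim (invert [¬p] (Q→P (invert [q])))
  when-⇔ (false because _)    (false because _)    _   _   _   = refl

  when-no : (P? : Dec P) {x : A} → ¬ P → when P? x ≡ 0#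
  when-no P? ¬p = cong (λ b → if b then _ else 0#) (dec-false P? ¬p)

  when-zero : (P? : Dec P) {x : A} → x ≡ 0# → when P? x ≡ 0#
  when-zero (true  because _) x≡0 = x≡0
  when-zero (false because _) _   = refl

  when-*ˡ : (P? : Dec P) (c x : A) → c * when P? x ≡ when P? (c * x)
  when-*ˡ (true  because _) c x = refl
  when-*ˡ (false because _) c x = zeroʳ c

  ∑-cong : (L : List I) {f g : I → A} → (∀ a → f a ≡ g a) → ∑ L f ≡ ∑ L g
  ∑-cong []      e = refl
  ∑-cong (a ∷ L) e = cong₂ _+_ (e a) (∑-cong L e)

  ∑-zero : (L : List I) {f : I → A} → (∀ a → f a ≡ 0#) → ∑ L f ≡ 0#
  ∑-zero []      e = refl
  ∑-zero (a ∷ L) e = trans (cong₂ _+_ (e a) (∑-zero L e)) (+-identityʳ 0#)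

  ∑-++ : (L K : List I) (f : I → A) → ∑ (L ++ K) f ≡ ∑ L f + ∑ K f
  ∑-++ []      K f = sym (+-identityˡ _)
  ∑-++ (a ∷ L) K f = trans (cong (f a +_) (∑-++ L K f)) (sym (+-assoc (f a) _ _))

  ∑-+ : (L : List I) (f g : I → A) → ∑ L (λ a → f a + g a) ≡ ∑ L f + ∑ L g
  ∑-+ []      f g = sym (+-identityʳ 0#)
  ∑-+ (a ∷ L) f g = trans (cong ((f a + g a) +_) (∑-+ L f g)) (interchange (f a) (g a) _ _)

  ∑-*ˡ : (L : List I) (c : A) (f : I → A) → c * ∑ L f ≡ ∑ L (λ a → c * f a)
  ∑-*ˡ []      c f = zeroʳ c
  ∑-*ˡ (a ∷ L) c f = trans (distribˡ c (f a) _) (cong ((c * f a) +_) (∑-*ˡ L c f))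

  ∑-neg : (L : List I) (g : I → A) → neg (∑ L g) ≡ ∑ L (neg ∘ g)
  ∑-neg L g = sym (inverseʳ-unique (∑ L g) _ (begin
    ∑ L g + ∑ L (neg ∘ g)          ≡⟨ ∑-+ L g (neg ∘ g) ⟨
    ∑ L (λ a → g a + neg (g a))    ≡⟨ ∑-zero L (λ a → -‿inverseʳ (g a)) ⟩
    0#                             ∎))

  ∑-sub : (L : List I) (f g : I → A) → ∑ L f + neg (∑ L g) ≡ ∑ L (λ a → f a + neg (g a))
  ∑-sub L f g = trans (cong (∑ L f +_) (∑-neg L g)) (sym (∑-+ L f (neg ∘ g)))

  ∑-map : (L : List I′) (h : I′ → I) (f : I → A) → ∑ (map h L) f ≡ ∑ L (f ∘ h)
  ∑-map []      h f = refl
  ∑-map (a ∷ L) h f = cong (f (h a) +_) (∑-map L h f)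

  ∑-concatMap : (L : List I′) (h : I′ → List I) (f : I → A) →
                ∑ (concatMap h L) f ≡ ∑ L (λ b → ∑ (h b) f)
  ∑-concatMap []      h f = refl
  ∑-concatMap (b ∷ L) h f = trans (∑-++ (h b) (concatMap h L) f) (cong (∑ (h b) f +_) (∑-concatMap L h f))

  ∑-filter : {ℓ : Level} {P : Pred I ℓ} (P? : Decidable P) (L : List I) (f : I → A) →
             ∑ (filter P? L) f ≡ ∑ L (λ a → when (P? a) (f a))
  ∑-filter P? []      f = refl
  ∑-filter P? (a ∷ L) f with does (P? a)
  ... | true  = cong (f a +_) (∑-filter P? L f)
  ... | false = trans (∑-filter P? L f) (sym (+-identityˡ _))

  ∑-swap : (L : List I) (K : List I′) (f : I → I′ → A) →
           ∑ L (λ a → ∑ K (f a)) ≡ ∑ K (λ b → ∑ L (λ a → f a b))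
  ∑-swap []      K f = sym (∑-zero K (λ _ → refl))
  ∑-swap (a ∷ L) K f = trans (cong (∑ K (f a) +_) (∑-swap L K f)) (sym (∑-+ K (f a) _))

  ∏-cong : (L : List I) {f g : I → A} → (∀ a → f a ≡ g a) → ∏ L f ≡ ∏ L g
  ∏-cong []      e = refl
  ∏-cong (a ∷ L) e = cong₂ _*_ (e a) (∏-cong L e)

  ∏-zero : (L : List I) {f : I → A} {a : I} → a ∈ L → f a ≡ 0# → ∏ L f ≡ 0#
  ∏-zero (b ∷ L) {f} (here refl) e = trans (cong (_* ∏ L f) e) (zeroˡ (∏ L f))
  ∏-zero (b ∷ L) {f} (there a∈L) e = trans (cong (f b *_) (∏-zero L a∈L e)) (zeroʳ (f b))

  ∑-allFin-suc : ∀ n (f : Fin (suc n) → A) → ∑ (allFin (suc n)) f ≡ f Fin.zero + ∑ (allFin n) (f ∘ Fin.suc)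
  ∑-allFin-suc n f = cong ((f Fin.zero) +_) (cong (foldr _+_ 0#)
    (trans (map-tabulate Fin.suc f) (sym (map-tabulate (λ i → i) (f ∘ Fin.suc)))))

  ∏-allFin-suc : ∀ n (f : Fin (suc n) → A) → ∏ (allFin (suc n)) f ≡ f Fin.zero * ∏ (allFin n) (f ∘ Fin.suc)
  ∏-allFin-suc n f = cong ((f Fin.zero) *_) (cong (foldr _*_ 1#)
    (trans (map-tabulate Fin.suc f) (sym (map-tabulate (λ i → i) (f ∘ Fin.suc)))))

  ∑<-suc : ∀ n f → ∑< (suc n) f ≡ f 0 + ∑< n (f ∘ suc)
  ∑<-suc n f = cong ((f 0) +_) (cong (foldr _+_ 0#)
    (trans (map-applyUpTo suc f n) (sym (map-applyUpTo (λ i → i) (f ∘ suc) n))))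

  ∑<-last : ∀ n f → ∑< (suc n) f ≡ ∑< n f + f n
  ∑<-last zero    f = trans (+-identityʳ (f 0)) (sym (+-identityˡ (f 0)))
  ∑<-last (suc n) f = begin
    ∑< (suc (suc n)) f                ≡⟨ ∑<-suc (suc n) f ⟩
    f 0 + ∑< (suc n) (f ∘ suc)        ≡⟨ cong ((f 0) +_) (∑<-last n (f ∘ suc)) ⟩
    f 0 + (∑< n (f ∘ suc) + f (suc n)) ≡⟨ +-assoc _ _ _ ⟨
    (f 0 + ∑< n (f ∘ suc)) + f (suc n) ≡⟨ cong (_+ f (suc n)) (∑<-suc n f) ⟨
    ∑< (suc n) f + f (suc n)          ∎

  ∑<-cong : ∀ n {f g : ℕ → A} → (∀ i → i ℕ.< n → f i ≡ g i) → ∑< n f ≡ ∑< n g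
  ∑<-cong zero    e = refl
  ∑<-cong (suc n) {f} {g} e = begin
    ∑< (suc n) f            ≡⟨ ∑<-suc n f ⟩
    f 0 + ∑< n (f ∘ suc)    ≡⟨ cong₂ _+_ (e 0 (ℕ.s≤s ℕ.z≤n)) (∑<-cong n (λ i i<n → e (suc i) (ℕ.s≤s i<n))) ⟩
    g 0 + ∑< n (g ∘ suc)    ≡⟨ ∑<-suc n g ⟨
    ∑< (suc n) g            ∎

  ∑<-truncate : ∀ T d (G : ℕ → A) → (∀ i → T ℕ.≤ i → G i ≡ 0#) → ∑< (T ℕ.+ d) G ≡ ∑< T G
  ∑<-truncate T zero    G vanish = cong (λ n → ∑< n G) (ℕP.+-identityʳ T)
  ∑<-truncate T (suc d) G vanish = begin
    ∑< (T ℕ.+ suc d) G           ≡⟨ cong (λ n → ∑< n G) (ℕP.+-suc T d) ⟩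
    ∑< (suc (T ℕ.+ d)) G         ≡⟨ ∑<-last (T ℕ.+ d) G ⟩
    ∑< (T ℕ.+ d) G + G (T ℕ.+ d) ≡⟨ cong₂ _+_ (∑<-truncate T d G vanish) (vanish (T ℕ.+ d) (ℕP.m≤m+n T d)) ⟩
    ∑< T G + 0#                  ≡⟨ +-identityʳ _ ⟩
    ∑< T G                       ∎

  ∑<-triangle : ∀ n (F : ℕ → ℕ → A) →
    ∑< (suc n) (λ m → ∑< (n ∸ m) (λ a → F a m)) ≡ ∑< n (λ a → ∑< (suc (n ∸ suc a)) (F a))
  ∑<-triangle zero    F = +-identityʳ 0#
  ∑<-triangle (suc n) F = begin
    ∑< (suc (suc n)) (λ m → ∑< (suc n ∸ m) (λ a → F a m))
      ≡⟨ ∑<-last (suc n) _ ⟩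
    ∑< (suc n) (λ m → ∑< (suc n ∸ m) (λ a → F a m)) + ∑< (n ∸ n) (λ a → F a (suc n))
      ≡⟨ cong₂ _+_ (∑<-cong (suc n) (λ m m≤n → trans (cong (λ k → ∑< k (λ a → F a m)) (ℕP.+-∸-assoc 1 (ℕP.≤-pred m≤n)))
                                                      (∑<-suc (n ∸ m) (λ a → F a m))))
                   (cong (λ k → ∑< k (λ a → F a (suc n))) (ℕP.n∸n≡0 n)) ⟩
    ∑< (suc n) (λ m → F 0 m + ∑< (n ∸ m) (λ a → F (suc a) m)) + 0#
      ≡⟨ +-identityʳ _ ⟩
    ∑< (suc n) (λ m → F 0 m + ∑< (n ∸ m) (λ a → F (suc a) m))
      ≡⟨ ∑-+ (upTo (suc n)) (F 0) _ ⟩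
    ∑< (suc n) (F 0) + ∑< (suc n) (λ m → ∑< (n ∸ m) (λ a → F (suc a) m))
      ≡⟨ cong (∑< (suc n) (F 0) +_) (∑<-triangle n (F ∘ suc)) ⟩
    ∑< (suc n) (F 0) + ∑< n (λ a → ∑< (suc (n ∸ suc a)) (F (suc a)))
      ≡⟨ ∑<-suc n (λ a → ∑< (suc (suc n ∸ suc a)) (F a)) ⟨
    ∑< (suc n) (λ a → ∑< (suc (suc n ∸ suc a)) (F a)) ∎

module CompositionSums {A : Set} {_+_ _*_ : Op₂ A} {neg : Op₁ A} {0# 1# : A}
                       (ring : IsCommutativeRing _≡_ _+_ _*_ neg 0# 1#) where

  open FiniteSums ring

  ∑comp : ∀ k → ℕ → (Vec ℕ k → A) → A
  ∑comp zero    t h = when (0 ℕ.≟ t) (h Vec.[])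
  ∑comp (suc k) t h = ∑< t (λ a → ∑comp k (t ∸ suc a) (h ∘ (suc a Vec.∷_)))

  isComposition? : ∀ {k} (t : ℕ) (ℓs : Vec ℕ k) → Dec (VAll.All (1 ℕ.≤_) ℓs × Vec.sum ℓs ≡ t)
  isComposition? t ℓs = VAll.all? (λ a → 1 ℕ.≤? a) ℓs ×-dec (Vec.sum ℓs ℕ.≟ t)

  ∑comp-small : ∀ k t h → t ℕ.< k → ∑comp k t h ≡ 0#
  ∑comp-small (suc k) t h (ℕ.s≤s t≤k) = trans
    (∑<-cong t (λ a a<t → ∑comp-small k (t ∸ suc a) _ (ℕP.<-≤-trans (ℕP.∸-monoʳ-< (ℕP.0<1+n {a}) a<t) t≤k)))
    (∑-zero (upTo t) (λ _ → refl))

  ∑-bounded-compositions : ∀ k b t (h : Vec ℕ k → A) → t ℕ.≤ b →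
    ∑ (boundedVecs k b) (λ ℓs → when (isComposition? t ℓs) (h ℓs)) ≡ ∑comp k t h
  ∑-bounded-compositions zero    b t h t≤b =
    trans (+-identityʳ _) (when-⇔ (isComposition? t Vec.[]) (0 ℕ.≟ t) proj₂ (VAll.[] ,_) refl)
  ∑-bounded-compositions (suc k) b t h t≤b = begin
    ∑ (boundedVecs (suc k) b) φ
      ≡⟨ ∑-concatMap (upTo (suc b)) (λ a → map (a Vec.∷_) (boundedVecs k b)) φ ⟩
    ∑< (suc b) (λ a → ∑ (map (a Vec.∷_) (boundedVecs k b)) φ)
      ≡⟨ ∑-cong (upTo (suc b)) (λ a → ∑-map (boundedVecs k b) (a Vec.∷_) φ) ⟩
    ∑< (suc b) G
      ≡⟨ ∑<-suc b G ⟩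
    G 0 + ∑< b (G ∘ suc)
      ≡⟨ cong₂ _+_ (sym (∑-zero (boundedVecs k b) (λ ℓs →
                     when-no (isComposition? t (0 Vec.∷ ℓs)) {h (0 Vec.∷ ℓs)} λ { (() VAll.∷ _ , _) })))
                   (cong (λ n → ∑< n (G ∘ suc)) (ℕP.m+[n∸m]≡n t≤b)) ⟨
    0# + ∑< (t ℕ.+ (b ∸ t)) (G ∘ suc)
      ≡⟨ +-identityˡ _ ⟩
    ∑< (t ℕ.+ (b ∸ t)) (G ∘ suc)
      ≡⟨ ∑<-truncate t (b ∸ t) (G ∘ suc) too-large ⟩
    ∑< t (G ∘ suc)
      ≡⟨ ∑<-cong t first-part ⟩
    ∑comp (suc k) t h ∎
    where
    φ : Vec ℕ (suc k) → A
    φ ℓs = when (isComposition? t ℓs) (h ℓs)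
    G : ℕ → A
    G a = ∑ (boundedVecs k b) (λ ℓs → φ (a Vec.∷ ℓs))
    too-large : ∀ a → t ℕ.≤ a → G (suc a) ≡ 0#
    too-large a t≤a = ∑-zero (boundedVecs k b) λ ℓs → when-no (isComposition? t (suc a Vec.∷ ℓs))
      λ (_ , sum≡t) → ℕP.<-irrefl (sym sum≡t) (ℕP.<-≤-trans (ℕ.s≤s t≤a) (ℕP.m≤m+n (suc a) (Vec.sum ℓs)))
    first-part : ∀ a → a ℕ.< t → G (suc a) ≡ ∑comp k (t ∸ suc a) (h ∘ (suc a Vec.∷_))
    first-part a a<t = trans
      (∑-cong (boundedVecs k b) λ ℓs → when-⇔ (isComposition? t (suc a Vec.∷ ℓs)) (isComposition? (t ∸ suc a) ℓs)
         (λ { (_ VAll.∷ pos , sum≡t) → pos , trans (sym (ℕP.m+n∸m≡n (suc a) (Vec.sum ℓs))) (cong (_∸ suc a) sum≡t) })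
         (λ (pos , sum≡t∸a) → ℕ.s≤s ℕ.z≤n VAll.∷ pos , trans (cong (suc a ℕ.+_) sum≡t∸a) (ℕP.m+[n∸m]≡n a<t))
         refl)
      (∑-bounded-compositions k b (t ∸ suc a) (h ∘ (suc a Vec.∷_)) (ℕP.≤-trans (ℕP.m∸n≤m t (suc a)) t≤b))

  -- the sum of g ℓs r over all ℓ₁, …, ℓ_k ≥ 1 and r ≥ 0 with ℓ₁ + … + ℓ_k + r = t,
  -- by the first part
  ∑parts : ∀ k → ℕ → (Vec ℕ k → ℕ → A) → A
  ∑parts zero    t g = g Vec.[] t
  ∑parts (suc k) t g = ∑< t (λ a → ∑parts k (t ∸ suc a) (λ ℓs r → g (suc a Vec.∷ ℓs) r))

  ∑parts-cong : ∀ k t {g g' : Vec ℕ k → ℕ → A} → (∀ ℓs r → g ℓs r ≡ g' ℓs r) → ∑parts k t g ≡ ∑parts k t g'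
  ∑parts-cong zero    t g≗g' = g≗g' Vec.[] t
  ∑parts-cong (suc k) t g≗g' = ∑-cong (upTo t) (λ a → ∑parts-cong k (t ∸ suc a) (λ ℓs r → g≗g' (suc a Vec.∷ ℓs) r))

  -- Remainders m > t - k leave fewer than k for the k positive parts.
  ∑comp-remainder-range : ∀ k t (h : ℕ → Vec ℕ k → A) → k ℕ.≤ t →
    ∑< (suc (t ∸ k)) (λ m → ∑comp k (t ∸ m) (h m)) ≡ ∑< (suc t) (λ m → ∑comp k (t ∸ m) (h m))
  ∑comp-remainder-range zero    t h _   = refl
  ∑comp-remainder-range (suc k) t h k≤t = sym (begin
    ∑< (suc t) C                          ≡⟨ cong (λ n → ∑< n C) size ⟨
    ∑< (suc (t ∸ suc k) ℕ.+ suc k) C      ≡⟨ ∑<-truncate (suc (t ∸ suc k)) (suc k) C vanish ⟩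
    ∑< (suc (t ∸ suc k)) C                ∎)
    where
    C : ℕ → A
    C m = ∑comp (suc k) (t ∸ m) (h m)
    size : suc (t ∸ suc k) ℕ.+ suc k ≡ suc t
    size = cong suc (ℕP.m∸n+n≡m k≤t)
    vanish : ∀ i → suc (t ∸ suc k) ℕ.≤ i → C i ≡ 0#
    vanish i i>t∸k = ∑comp-small (suc k) (t ∸ i) (h i)
      (ℕP.m<n+o⇒m∸n<o t i (ℕP.≤-trans (ℕP.≤-reflexive (sym size)) (ℕP.+-monoˡ-≤ (suc k) i>t∸k)))

  ∑parts-by-remainder : ∀ k t (g : Vec ℕ k → ℕ → A) →
    ∑< (suc t) (λ m → ∑comp k (t ∸ m) (λ ℓs → g ℓs m)) ≡ ∑parts k t g
  ∑parts-by-remainder zero t g = begin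
    ∑< (suc t) (λ m → when (0 ℕ.≟ t ∸ m) (g Vec.[] m))
      ≡⟨ ∑<-last t _ ⟩
    ∑< t (λ m → when (0 ℕ.≟ t ∸ m) (g Vec.[] m)) + when (0 ℕ.≟ t ∸ t) (g Vec.[] t)
      ≡⟨ cong₂ _+_ (trans (∑<-cong t (λ m m<t →
                            when-no (0 ℕ.≟ t ∸ m) λ 0≡t∸m → ℕP.<⇒≢ (ℕP.m<n⇒0<n∸m m<t) 0≡t∸m))
                          (∑-zero (upTo t) (λ _ → refl)))
                   (cong (λ n → when (0 ℕ.≟ n) (g Vec.[] t)) (ℕP.n∸n≡0 t)) ⟩
    0# + g Vec.[] t
      ≡⟨ +-identityˡ _ ⟩
    g Vec.[] t ∎
  ∑parts-by-remainder (suc k) t g = begin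
    ∑< (suc t) (λ m → ∑< (t ∸ m) (λ a → ∑comp k (t ∸ m ∸ suc a) (λ ℓs → g (suc a Vec.∷ ℓs) m)))
      ≡⟨ ∑<-triangle t (λ a m → ∑comp k (t ∸ m ∸ suc a) (λ ℓs → g (suc a Vec.∷ ℓs) m)) ⟩
    ∑< t (λ a → ∑< (suc (t ∸ suc a)) (λ m → ∑comp k (t ∸ m ∸ suc a) (λ ℓs → g (suc a Vec.∷ ℓs) m)))
      ≡⟨ ∑-cong (upTo t) (λ a → trans
           (∑-cong (upTo (suc (t ∸ suc a))) (λ m → cong (λ n → ∑comp k n (λ ℓs → g (suc a Vec.∷ ℓs) m)) (∸-comm t m (suc a))))
           (∑parts-by-remainder k (t ∸ suc a) (λ ℓs r → g (suc a Vec.∷ ℓs) r))) ⟩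
    ∑parts (suc k) t g ∎
    where
    ∸-comm : ∀ n m a → n ∸ m ∸ a ≡ n ∸ a ∸ m
    ∸-comm n m a = trans (ℕP.∸-+-assoc n m a) (trans (cong (n ∸_) (ℕP.+-comm m a)) (sym (ℕP.∸-+-assoc n a m)))

  ∑-compositions≡∑parts : ∀ k t (g : Vec ℕ k → ℕ → A) → k ℕ.≤ t →
    ∑< (suc (t ∸ k)) (λ m → ∑ (compositions k (t ∸ m)) (λ ℓs → g ℓs m)) ≡ ∑parts k t g
  ∑-compositions≡∑parts k t g k≤t = begin
    ∑< (suc (t ∸ k)) (λ m → ∑ (compositions k (t ∸ m)) (λ ℓs → g ℓs m))
      ≡⟨ ∑-cong (upTo (suc (t ∸ k))) (λ m → trans (∑-filter (isComposition? (t ∸ m)) (boundedVecs k (t ∸ m)) (λ ℓs → g ℓs m))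
                                                (∑-bounded-compositions k (t ∸ m) (t ∸ m) (λ ℓs → g ℓs m) ℕP.≤-refl)) ⟩
    ∑< (suc (t ∸ k)) C
      ≡⟨ ∑comp-remainder-range k t (λ m ℓs → g ℓs m) k≤t ⟩
    ∑< (suc t) C
      ≡⟨ ∑parts-by-remainder k t g ⟩
    ∑parts k t g ∎
    where
    C : ℕ → A
    C m = ∑comp k (t ∸ m) (λ ℓs → g ℓs m)

module _ {p : ℕ} .{{_ : NonZero p}} where

  open FiniteSums (𝔽-isCommutativeRing {p})
  open CompositionSums (𝔽-isCommutativeRing {p})

  private variable N n : ℕ

  Row : ℕ → Set
  Row N = 𝔽^ p N × ℕ

  entry : Row N → Fin N → 𝔽 p
  entry = proj₁

  tag : Row N → ℕ
  tag = proj₂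

  Admissibleᶠ : (Fin n → Row N) → (Fin n → Fin N) → Set
  Admissibleᶠ row ρ =
    (∀ i i' → ρ i ≡ ρ i' → i ≡ i') ×
    (∀ i i' → i Fin.< i' → tag (row i) ≡ tag (row i') → ρ i Fin.< ρ i')

  admissibleᶠ? : (row : Fin n → Row N) (ρ : Fin n → Fin N) → Dec (Admissibleᶠ row ρ)
  admissibleᶠ? row ρ =
    all? (λ i → all? (λ i' → (ρ i ≟ᶠ ρ i') →-dec (i ≟ᶠ i'))) ×-dec
    all? (λ i → all? (λ i' → (i <ᶠ? i') →-dec ((tag (row i) ℕ.≟ tag (row i')) →-dec (ρ i <ᶠ? ρ i'))))

  weight : (Fin n → Row N) → (Fin n → Fin N) → 𝔽 p
  weight {n} row ρ = ∏ (allFin n) (λ i → entry (row i) (ρ i))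

  ℋᶠ : (n : ℕ) → (Fin n → Row N) → 𝔽 p
  ℋᶠ {N} n row = ∑ (filter (admissibleᶠ? row) (allFuns n N)) (weight row)

  ℋ≡ℋᶠ : (bs : List (Row N)) → ℋ bs ≡ ℋᶠ (nRows bs) (List.lookup (rows bs))
  ℋ≡ℋᶠ bs = refl

  Blocks : Fin N → ℕ → Row N → Fin N → Set
  Blocks j t w k = k ≡ j ⊎ (k Fin.< j × tag w ≡ t)

  blocks? : (j : Fin N) (t : ℕ) (w : Row N) (k : Fin N) → Dec (Blocks j t w k)
  blocks? j t w k = (k ≟ᶠ j) ⊎-dec ((k <ᶠ? j) ×-dec (tag w ℕ.≟ t))

  onEntries : {M : ℕ} → (Row N → 𝔽^ p M) → Row N → Row M
  onEntries h w = h w , tag w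

  mask : Fin N → ℕ → Row N → Row N
  mask j t = onEntries (λ w k → if does (blocks? j t w k) then 0F else entry w k)

  expand : (n : ℕ) → (Fin n → Row N) → 𝔽 p
  expand         zero    row = 1F
  expand {N = N} (suc n) row =
    ∑ (allFin N) (λ j → entry (row Fin.zero) j *F expand n (mask j (tag (row Fin.zero)) ∘ row ∘ Fin.suc))

  -- One step of the expansion, for a fixed ρ : sending row 0 to j = ρ 0,
  -- ρ is admissible iff its restriction to the remaining rows is admissible
  -- and avoids all blocked positions; a blocked position kills the masked weight.
  module FirstRow (row : Fin (suc n) → Row N) (ρ : Fin (suc n) → Fin N) where
    j : Fin N
    j = ρ Fin.zero
    t : ℕ
    t = tag (row Fin.zero)
    ρ' : Fin n → Fin N
    ρ' = ρ ∘ Fin.suc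
    row' : Fin n → Row N
    row' = mask j t ∘ row ∘ Fin.suc

    Avoids : Set
    Avoids = ∀ i → ¬ Blocks j t (row (Fin.suc i)) (ρ' i)

    restrict : Admissibleᶠ row ρ → Admissibleᶠ row' ρ' × Avoids
    restrict (inj , inc) =
      ( (λ i i' e → suc-injective (inj (Fin.suc i) (Fin.suc i') e))
      , (λ i i' i<i' e → inc (Fin.suc i) (Fin.suc i') (ℕ.s≤s i<i') e) )
      , avoids
      where
      avoids : Avoids
      avoids i (inj₁ ρi≡j)         with () ← inj (Fin.suc i) Fin.zero ρi≡j
      avoids i (inj₂ (ρi<j , same)) = <-asym ρi<j (inc Fin.zero (Fin.suc i) (ℕ.s≤s ℕ.z≤n) (sym same))

    extend : Admissibleᶠ row' ρ' → Avoids → Admissibleᶠ row ρ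
    extend (inj , inc) avoids = inj⁺ , inc⁺
      where
      inj⁺ : ∀ i i' → ρ i ≡ ρ i' → i ≡ i'
      inj⁺ Fin.zero         Fin.zero         _ = refl
      inj⁺ Fin.zero         (Fin.suc i') e = ⊥-elim (avoids i' (inj₁ (sym e)))
      inj⁺ (Fin.suc i)  Fin.zero         e = ⊥-elim (avoids i (inj₁ e))
      inj⁺ (Fin.suc i)  (Fin.suc i') e = cong Fin.suc (inj i i' e)
      inc⁺ : ∀ i i' → i Fin.< i' → tag (row i) ≡ tag (row i') → ρ i Fin.< ρ i'
      inc⁺ Fin.zero        (Fin.suc i') _ same with <-cmp (ρ' i') j
      ... | tri< ρi<j _ _ = ⊥-elim (avoids i' (inj₂ (ρi<j , sym same)))
      ... | tri≈ _ ρi≡j _ = ⊥-elim (avoids i' (inj₁ ρi≡j))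
      ... | tri> _ _ j<ρi = j<ρi
      inc⁺ (Fin.suc i) (Fin.suc i') (ℕ.s≤s i<i') same = inc i i' i<i' same

    weight-avoiding : Avoids → weight row' ρ' ≡ ∏ (allFin n) (λ i → entry (row (Fin.suc i)) (ρ' i))
    weight-avoiding avoids = ∏-cong (allFin n) λ i →
      cong (λ b → if b then 0F else entry (row (Fin.suc i)) (ρ' i)) (dec-false (blocks? j t (row (Fin.suc i)) (ρ' i)) (avoids i))

    weight-blocked : ∀ i → Blocks j t (row (Fin.suc i)) (ρ' i) → weight row' ρ' ≡ 0F
    weight-blocked i blocked = ∏-zero (allFin n) (∈-allFin i)
      (cong (λ b → if b then 0F else entry (row (Fin.suc i)) (ρ' i)) (dec-true (blocks? j t (row (Fin.suc i)) (ρ' i)) blocked))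

    weight-first : weight row ρ ≡ entry (row Fin.zero) j *F ∏ (allFin n) (λ i → entry (row (Fin.suc i)) (ρ' i))
    weight-first = ∏-allFin-suc n (λ i → entry (row i) (ρ i))

    step : when (admissibleᶠ? row ρ) (weight row ρ) ≡ entry (row Fin.zero) j *F when (admissibleᶠ? row' ρ') (weight row' ρ')
    step with all? (λ i → ¬? (blocks? j t (row (Fin.suc i)) (ρ' i)))
    ... | yes avoids = begin
      when (admissibleᶠ? row ρ) (weight row ρ)
        ≡⟨ when-⇔ (admissibleᶠ? row ρ) (admissibleᶠ? row' ρ') (proj₁ ∘ restrict) (λ adm' → extend adm' avoids)
                 (trans weight-first (cong (entry (row Fin.zero) j *F_) (sym (weight-avoiding avoids)))) ⟩
      when (admissibleᶠ? row' ρ') (entry (row Fin.zero) j *F weight row' ρ')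
        ≡⟨ when-*ˡ (admissibleᶠ? row' ρ') (entry (row Fin.zero) j) (weight row' ρ') ⟨
      entry (row Fin.zero) j *F when (admissibleᶠ? row' ρ') (weight row' ρ') ∎
    ... | no ¬avoids with (i , ¬¬blocked) ← ¬∀⟶∃¬ n _ (λ i → ¬? (blocks? j t (row (Fin.suc i)) (ρ' i))) ¬avoids = begin
      when (admissibleᶠ? row ρ) (weight row ρ)  ≡⟨ when-no (admissibleᶠ? row ρ) (¬avoids ∘ proj₂ ∘ restrict) ⟩
      0F                                       ≡⟨ zeroʳ (entry (row Fin.zero) j) ⟨
      entry (row Fin.zero) j *F 0F
        ≡⟨ cong (entry (row Fin.zero) j *F_)
                (when-zero (admissibleᶠ? row' ρ') (weight-blocked i (decidable-stable (blocks? j t (row (Fin.suc i)) (ρ' i)) ¬¬blocked))) ⟨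
      entry (row Fin.zero) j *F when (admissibleᶠ? row' ρ') (weight row' ρ') ∎

  ℋᶠ≡expand : ∀ n (row : Fin n → Row N) → ℋᶠ n row ≡ expand n row
  ℋᶠ≡expand         zero    row = +-identityʳ 1F
  ℋᶠ≡expand {N = N} (suc n) row = begin
    ℋᶠ (suc n) row
      ≡⟨ ∑-filter (admissibleᶠ? row) (allFuns (suc n) N) (weight row) ⟩
    ∑ (allFuns (suc n) N) (λ ρ → when (admissibleᶠ? row ρ) (weight row ρ))
      ≡⟨ ∑-concatMap (allFin N) _ _ ⟩
    _ ≡⟨ ∑-cong (allFin N) (λ j → begin
      _ ≡⟨ ∑-map (allFuns n N) _ _ ⟩
      _ ≡⟨ ∑-cong (allFuns n N) (λ ρ' → FirstRow.step row _) ⟩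
      _ ≡⟨ ∑-*ˡ (allFuns n N) (entry (row Fin.zero) j) _ ⟨
      entry (row Fin.zero) j *F ∑ (allFuns n N) (λ ρ' → when (admissibleᶠ? (row' j) ρ') (weight (row' j) ρ'))
        ≡⟨ cong (entry (row Fin.zero) j *F_) (∑-filter (admissibleᶠ? (row' j)) (allFuns n N) (weight (row' j))) ⟨
      entry (row Fin.zero) j *F ℋᶠ n (row' j)
        ≡⟨ cong (entry (row Fin.zero) j *F_) (ℋᶠ≡expand n (row' j)) ⟩
      entry (row Fin.zero) j *F expand n (row' j) ∎) ⟩
    expand (suc n) row ∎
    where
    row' : Fin N → Fin n → Row N
    row' j = mask j (tag (row Fin.zero)) ∘ row ∘ Fin.suc

  -- The recursion runs on
  -- the list length, since masking does not shorten the list structurally;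
  -- the fuel is always the exact length, so the clause for a too small fuel
  -- never matters.
  expandFuel : ℕ → List (Row N) → 𝔽 p
  expandFuel         _       []      = 1F
  expandFuel         zero    (_ ∷ _) = 0F
  expandFuel {N = N} (suc n) (w ∷ R) = ∑ (allFin N) (λ j → entry w j *F expandFuel n (map (mask j (tag w)) R))

  expandᴸ : List (Row N) → 𝔽 p
  expandᴸ R = expandFuel (length R) R

  expandᴸ-cons : (w : Row N) (R : List (Row N)) →
                 expandᴸ (w ∷ R) ≡ ∑ (allFin N) (λ j → entry w j *F expandᴸ (map (mask j (tag w)) R))
  expandᴸ-cons {N = N} w R = ∑-cong (allFin N) λ j →
    cong (λ n → entry w j *F expandFuel n (map (mask j (tag w)) R)) (sym (length-map (mask j (tag w)) R))

  expand≡expandFuel : ∀ n (row : Fin n → Row N) → expand n row ≡ expandFuel n (List.tabulate row)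
  expand≡expandFuel         zero    row = refl
  expand≡expandFuel {N = N} (suc n) row = ∑-cong (allFin N) λ j → cong (entry (row Fin.zero) j *F_) (begin
    expand n (mask j t ∘ row ∘ Fin.suc)                     ≡⟨ expand≡expandFuel n _ ⟩
    expandFuel n (List.tabulate (mask j t ∘ row ∘ Fin.suc)) ≡⟨ cong (expandFuel n) (map-tabulate (row ∘ Fin.suc) (mask j t)) ⟨
    expandFuel n (map (mask j t) (List.tabulate (row ∘ Fin.suc))) ∎)
    where t = tag (row Fin.zero)

  ℋ≡expandᴸ : (bs : List (Row N)) → ℋ bs ≡ expandᴸ (rows bs)
  ℋ≡expandᴸ bs = begin
    ℋ bs                                              ≡⟨ ℋ≡ℋᶠ bs ⟩
    ℋᶠ (nRows bs) (List.lookup (rows bs))             ≡⟨ ℋᶠ≡expand (nRows bs) (List.lookup (rows bs)) ⟩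
    expand (nRows bs) (List.lookup (rows bs))         ≡⟨ expand≡expandFuel (nRows bs) (List.lookup (rows bs)) ⟩
    expandFuel (nRows bs) (List.tabulate (List.lookup (rows bs))) ≡⟨ cong (expandFuel (nRows bs)) (tabulate-lookup (rows bs)) ⟩
    expandᴸ (rows bs)                                 ∎

  Split : ℕ → Set
  Split N = Row N × List (Row N)

  withRow : Row N → Split N → Split N
  withRow w (v , R) = v , w ∷ R

  otherBlock? : (w : Row N) (q : Split N) → Dec (¬ tag (proj₁ q) ≡ tag w)
  otherBlock? w q = ¬? (tag (proj₁ q) ℕ.≟ tag w)

  -- the rows of R that come first in their block, each split off from R
  leaders : List (Row N) → List (Split N)
  leaders []      = []
  leaders (w ∷ R) = (w , R) ∷ map (withRow w) (filter (otherBlock? w) (leaders R))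

  leaders-onEntries : {M : ℕ} (h : Row N → 𝔽^ p M) (R : List (Row N)) →
    leaders (map (onEntries h) R) ≡ map (λ q → onEntries h (proj₁ q) , map (onEntries h) (proj₂ q)) (leaders R)
  leaders-onEntries h []      = refl
  leaders-onEntries h (w ∷ R) = cong ((g w , map g R) ∷_) (begin
    map (withRow (g w)) (filter (otherBlock? (g w)) (leaders (map g R)))
      ≡⟨ cong (map (withRow (g w)) ∘ filter (otherBlock? (g w))) (leaders-onEntries h R) ⟩
    map (withRow (g w)) (filter (otherBlock? (g w)) (map G (leaders R)))
      ≡⟨ cong (map (withRow (g w))) (filter-map (otherBlock? (g w)) G (leaders R)) ⟩
    map (withRow (g w)) (map G (filter (otherBlock? w) (leaders R)))
      ≡⟨ map-∘ (filter (otherBlock? w) (leaders R)) ⟨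
    map (G ∘ withRow w) (filter (otherBlock? w) (leaders R))
      ≡⟨ map-∘ (filter (otherBlock? w) (leaders R)) ⟩
    map G (map (withRow w) (filter (otherBlock? w) (leaders R))) ∎)
    where
    g = onEntries h
    G = λ (q : Split _) → g (proj₁ q) , map g (proj₂ q)

  dropCol : Row (suc N) → Row N
  dropCol = onEntries (λ w → entry w ∘ Fin.suc)

  dropCol-mask₀ : (t : ℕ) (R : List (Row (suc N))) → map dropCol (map (mask Fin.zero t) R) ≡ map dropCol R
  dropCol-mask₀ t R = sym (map-∘ R)

  dropCol-mask : (j : Fin N) (t : ℕ) (R : List (Row (suc N))) →
                 map dropCol (map (mask (Fin.suc j) t) R) ≡ map (mask j t) (map dropCol R)
  dropCol-mask j t R = trans (sym (map-∘ R)) (map-∘ R)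

  -- the contribution of a leader v using column 0, the others then filling the remaining columns
  leaderTerm : Split (suc N) → 𝔽 p
  leaderTerm (v , R) = entry v Fin.zero *F expandᴸ (map dropCol R)

  -- When the first row w takes a column j+1 ≥ 1, a later leader v may still take
  -- column 0 exactly when it lies in another block than w.
  later-leaders : (w : Row (suc N)) (R : List (Row (suc N))) →
    ∑ (allFin N) (λ j → entry w (Fin.suc j) *F ∑ (leaders (map (mask (Fin.suc j) (tag w)) R)) leaderTerm)
    ≡ ∑ (map (withRow w) (filter (otherBlock? w) (leaders R))) leaderTerm
  later-leaders {N = N} w R = begin
    ∑ (allFin N) (λ j → w₊ j *F ∑ (leaders (map (mask (Fin.suc j) t) R)) leaderTerm)
      ≡⟨ ∑-cong (allFin N) (λ j → cong (w₊ j *F_) (masked-leaders j)) ⟩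
    ∑ (allFin N) (λ j → w₊ j *F ∑ (leaders R) (λ q → κ q *F E q j))
      ≡⟨ ∑-cong (allFin N) (λ j → ∑-*ˡ (leaders R) (w₊ j) _) ⟩
    ∑ (allFin N) (λ j → ∑ (leaders R) (λ q → w₊ j *F (κ q *F E q j)))
      ≡⟨ ∑-swap (allFin N) (leaders R) _ ⟩
    ∑ (leaders R) (λ q → ∑ (allFin N) (λ j → w₊ j *F (κ q *F E q j)))
      ≡⟨ ∑-cong (leaders R) (λ q → begin
           ∑ (allFin N) (λ j → w₊ j *F (κ q *F E q j))   ≡⟨ ∑-cong (allFin N) (λ j → x∙yz≈y∙xz (w₊ j) (κ q) (E q j)) ⟩
           ∑ (allFin N) (λ j → κ q *F (w₊ j *F E q j))   ≡⟨ ∑-*ˡ (allFin N) (κ q) _ ⟨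
           κ q *F ∑ (allFin N) (λ j → w₊ j *F E q j)     ≡⟨ cong (κ q *F_) (expandᴸ-cons (dropCol w) (map dropCol (proj₂ q))) ⟨
           κ q *F expandᴸ (map dropCol (w ∷ proj₂ q))    ≡⟨ κ-term q ⟩
           when (otherBlock? w q) (leaderTerm (withRow w q)) ∎) ⟩
    ∑ (leaders R) (λ q → when (otherBlock? w q) (leaderTerm (withRow w q)))
      ≡⟨ ∑-filter (otherBlock? w) (leaders R) (leaderTerm ∘ withRow w) ⟨
    ∑ (filter (otherBlock? w) (leaders R)) (leaderTerm ∘ withRow w)
      ≡⟨ ∑-map (filter (otherBlock? w) (leaders R)) (withRow w) leaderTerm ⟨
    ∑ (map (withRow w) (filter (otherBlock? w) (leaders R))) leaderTerm ∎
    where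
    t = tag w
    w₊ : Fin N → 𝔽 p
    w₊ j = entry w (Fin.suc j)
    -- column 0 of a leader v after masking at column j+1: zero iff v is in w's block
    κ : Split (suc N) → 𝔽 p
    κ (v , _) = if does (tag v ℕ.≟ t) then 0F else entry v Fin.zero
    E : Split (suc N) → Fin N → 𝔽 p
    E (_ , R') j = expandᴸ (map (mask j t) (map dropCol R'))

    masked-leaders : ∀ j → ∑ (leaders (map (mask (Fin.suc j) t) R)) leaderTerm ≡ ∑ (leaders R) (λ q → κ q *F E q j)
    masked-leaders j = begin
      ∑ (leaders (map (mask (Fin.suc j) t) R)) leaderTerm        ≡⟨ cong (λ L → ∑ L leaderTerm) (leaders-onEntries _ R) ⟩
      ∑ (map _ (leaders R)) leaderTerm                           ≡⟨ ∑-map (leaders R) _ leaderTerm ⟩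
      ∑ (leaders R) _
        ≡⟨ ∑-cong (leaders R) (λ q → cong (λ R' → κ q *F expandᴸ R') (dropCol-mask j t (proj₂ q))) ⟩
      ∑ (leaders R) (λ q → κ q *F E q j)                         ∎

    κ-term : ∀ q → κ q *F expandᴸ (map dropCol (w ∷ proj₂ q)) ≡ when (otherBlock? w q) (leaderTerm (withRow w q))
    κ-term (v , _) with does (tag v ℕ.≟ t)
    ... | true  = zeroˡ _
    ... | false = refl

  -- Column expansion: either no row uses column 0, or column 0 is used by a
  -- row that must be the first of its block (rows of a block are increasing).
  column-expansion : ∀ n (R : List (Row (suc N))) → length R ≡ n →
                     expandᴸ R ≡ expandᴸ (map dropCol R) +F ∑ (leaders R) leaderTerm
  column-expansion         zero    []      _   = sym (+-identityʳ 1F)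
  column-expansion {N = N} (suc n) (w ∷ R) len = begin
    expandᴸ (w ∷ R)
      ≡⟨ expandᴸ-cons w R ⟩
    ∑ (allFin (suc N)) (λ j → entry w j *F expandᴸ (map (mask j t) R))
      ≡⟨ ∑-allFin-suc N _ ⟩
    w₀ *F expandᴸ (map (mask Fin.zero t) R) +F ∑ (allFin N) (λ j → w₊ j *F expandᴸ (map (mask (Fin.suc j) t) R))
      ≡⟨ cong₂ _+F_ (cong (w₀ *F_) column-0-unused) (∑-cong (allFin N) (λ j → cong (w₊ j *F_) (column-j+1-used j))) ⟩
    w₀ *F expandᴸ (map dropCol R) +F ∑ (allFin N) (λ j → w₊ j *F (A j +F B j))
      ≡⟨ cong (w₀ *F expandᴸ (map dropCol R) +F_)
              (trans (∑-cong (allFin N) (λ j → distribˡ (w₊ j) (A j) (B j))) (∑-+ (allFin N) _ _)) ⟩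
    w₀ *F expandᴸ (map dropCol R) +F (∑ (allFin N) (λ j → w₊ j *F A j) +F ∑ (allFin N) (λ j → w₊ j *F B j))
      ≡⟨ x∙yz≈y∙xz⁺ _ _ _ ⟩
    ∑ (allFin N) (λ j → w₊ j *F A j) +F (w₀ *F expandᴸ (map dropCol R) +F ∑ (allFin N) (λ j → w₊ j *F B j))
      ≡⟨ cong₂ _+F_ (expandᴸ-cons (dropCol w) (map dropCol R)) (cong (leaderTerm (w , R) +F_) (sym (later-leaders w R))) ⟨
    expandᴸ (map dropCol (w ∷ R)) +F ∑ (leaders (w ∷ R)) leaderTerm ∎
    where
    t = tag w
    w₀ = entry w Fin.zero
    w₊ : Fin N → 𝔽 p
    w₊ j = entry w (Fin.suc j)
    A B : Fin N → 𝔽 p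
    A j = expandᴸ (map (mask j t) (map dropCol R))
    B j = ∑ (leaders (map (mask (Fin.suc j) t) R)) leaderTerm
    masked-length : ∀ j → length (map (mask j t) R) ≡ n
    masked-length j = trans (length-map (mask j t) R) (ℕP.suc-injective len)

    -- masking at column 0 empties column 0, so no leader can use it
    column-0-unused : expandᴸ (map (mask Fin.zero t) R) ≡ expandᴸ (map dropCol R)
    column-0-unused = begin
      expandᴸ (map (mask Fin.zero t) R)
        ≡⟨ column-expansion n (map (mask Fin.zero t) R) (masked-length Fin.zero) ⟩
      expandᴸ (map dropCol (map (mask Fin.zero t) R)) +F ∑ (leaders (map (mask Fin.zero t) R)) leaderTerm
        ≡⟨ cong₂ _+F_ (cong expandᴸ (dropCol-mask₀ t R))
                      (trans (cong (λ L → ∑ L leaderTerm) (leaders-onEntries _ R))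
                             (trans (∑-map (leaders R) _ leaderTerm) (∑-zero (leaders R) (λ _ → zeroˡ _)))) ⟩
      expandᴸ (map dropCol R) +F 0F
        ≡⟨ +-identityʳ _ ⟩
      expandᴸ (map dropCol R) ∎

    column-j+1-used : ∀ j → expandᴸ (map (mask (Fin.suc j) t) R) ≡ A j +F B j
    column-j+1-used j = trans (column-expansion n (map (mask (Fin.suc j) t) R) (masked-length (Fin.suc j)))
                              (cong (_+F B j) (cong expandᴸ (dropCol-mask j t R)))

  Block : ℕ → Set
  Block N = 𝔽^ p N × ℕ

  Removal : ℕ → Set
  Removal N = 𝔽^ p N × List (Block N)

  under : Block N → Removal N → Removal N
  under b (r , bs) = r , b ∷ bs

  removeFirst : Block N → List (Block N) → List (Removal N)
  removeFirst (r , zero)  bs = []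
  removeFirst (r , suc ℓ) bs = (r , (r , ℓ) ∷ bs) ∷ []

  decrements : List (Block N) → List (Removal N)
  decrements []       = []
  decrements (b ∷ bs) = removeFirst b bs ++ map (under b) (decrements bs)

  rowsFrom-map : {M : ℕ} (f : 𝔽^ p N → 𝔽^ p M) (t : ℕ) (bs : List (Block N)) →
                 map (onEntries (f ∘ entry)) (rowsFrom t bs) ≡ rowsFrom t (map (onEntries (f ∘ entry)) bs)
  rowsFrom-map f t []             = refl
  rowsFrom-map f t ((r , ℓ) ∷ bs) = trans (map-++ _ (List.replicate ℓ (r , t)) (rowsFrom (suc t) bs))
    (cong₂ _++_ (map-replicate _ ℓ (r , t)) (rowsFrom-map f (suc t) bs))

  rowsFrom-tags : ∀ t (bs : List (Block N)) → All (λ w → t ℕ.≤ tag w) (rowsFrom t bs)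
  rowsFrom-tags t []             = []
  rowsFrom-tags t ((r , ℓ) ∷ bs) = ++⁺ (replicate⁺ ℓ ℕP.≤-refl) (All.map (ℕP.≤-trans (ℕP.n≤1+n t)) (rowsFrom-tags (suc t) bs))

  leaders-All : {P : Row N → Set} (R : List (Row N)) → All P R → All (P ∘ proj₁) (leaders R)
  leaders-All []      []         = []
  leaders-All (w ∷ R) (pw ∷ pR) = pw ∷ map⁺ (filter⁺ (otherBlock? w) (leaders-All R pR))

  prefix : List (Row N) → Split N → Split N
  prefix Y (v , R) = v , Y ++ R

  leaders-replicate : (w : Row N) (ℓ : ℕ) (X : List (Row N)) → All (λ v → suc (tag w) ℕ.≤ tag v) X →
    filter (otherBlock? w) (leaders (List.replicate ℓ w ++ X)) ≡ map (prefix (List.replicate ℓ w)) (leaders X)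
  leaders-replicate w zero    X later = trans (filter-all (otherBlock? w) (All.map (λ lt eq → ℕP.<-irrefl (sym eq) lt) (leaders-All X later)))
                                              (sym (map-id (leaders X)))
  leaders-replicate w (suc ℓ) X later = begin
    filter (otherBlock? w) (leaders (w ∷ Y))
      ≡⟨ filter-reject (otherBlock? w) (λ ne → ne refl) ⟩
    filter (otherBlock? w) (map (withRow w) (filter (otherBlock? w) (leaders Y)))
      ≡⟨ filter-map (otherBlock? w) (withRow w) (filter (otherBlock? w) (leaders Y)) ⟩
    map (withRow w) (filter (otherBlock? w) (filter (otherBlock? w) (leaders Y)))
      ≡⟨ cong (map (withRow w)) (filter-idem (otherBlock? w) (leaders Y)) ⟩
    map (withRow w) (filter (otherBlock? w) (leaders Y))
      ≡⟨ cong (map (withRow w)) (leaders-replicate w ℓ X later) ⟩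
    map (withRow w) (map (prefix (List.replicate ℓ w)) (leaders X))
      ≡⟨ map-∘ (leaders X) ⟨
    map (prefix (List.replicate (suc ℓ) w)) (leaders X) ∎
    where Y = List.replicate ℓ w ++ X

  leaders-rows : ∀ t (bs : List (Block N)) →
    map (λ q → entry (proj₁ q) , proj₂ q) (leaders (rowsFrom t bs)) ≡ map (λ q → proj₁ q , rowsFrom t (proj₂ q)) (decrements bs)
  leaders-rows t []                 = refl
  leaders-rows t ((r , zero) ∷ bs)  = trans (leaders-rows (suc t) bs) (map-∘ (decrements bs))
  leaders-rows t ((r , suc ℓ) ∷ bs) = cong ((r , Y) ∷_) (begin
    map E (map (withRow (r , t)) (filter (otherBlock? (r , t)) (leaders Y)))
      ≡⟨ cong (map E ∘ map (withRow (r , t))) (leaders-replicate (r , t) ℓ X (rowsFrom-tags (suc t) bs)) ⟩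
    map E (map (withRow (r , t)) (map (prefix (List.replicate ℓ (r , t))) (leaders X)))
      ≡⟨ trans (sym (map-∘ _)) (sym (map-∘ (leaders X))) ⟩
    map (λ q → entry (proj₁ q) , (r , t) ∷ Y' (proj₂ q)) (leaders X)
      ≡⟨ map-∘ (leaders X) ⟩
    map (λ q → proj₁ q , (r , t) ∷ Y' (proj₂ q)) (map E (leaders X))
      ≡⟨ cong (map (λ q → proj₁ q , (r , t) ∷ Y' (proj₂ q))) (leaders-rows (suc t) bs) ⟩
    map (λ q → proj₁ q , (r , t) ∷ Y' (proj₂ q)) (map (λ q → proj₁ q , rowsFrom (suc t) (proj₂ q)) (decrements bs))
      ≡⟨ trans (sym (map-∘ (decrements bs))) (map-∘ (decrements bs)) ⟩
    map (λ q → proj₁ q , rowsFrom t (proj₂ q)) (map (under (r , suc ℓ)) (decrements bs)) ∎)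
    where
    E : Split _ → Removal _
    E q = entry (proj₁ q) , proj₂ q
    X = rowsFrom (suc t) bs
    Y = List.replicate ℓ (r , t) ++ X
    Y' = λ R → List.replicate ℓ (r , t) ++ R

  -- From here on ℋ is used only through the properties proved below; H is
  -- ℋ behind an opaque definition, so that the type checker never unfolds
  -- the (large) definition of ℋ when comparing terms.
  opaque
    H : List (Block N) → 𝔽 p
    H = ℋ

    H≡ℋ : (bs : List (Block N)) → H bs ≡ ℋ bs
    H≡ℋ bs = refl

  H≡expandᴸ : (bs : List (Block N)) → H bs ≡ expandᴸ (rows bs)
  H≡expandᴸ bs = trans (H≡ℋ bs) (ℋ≡expandᴸ bs)

  dropColᵇ : List (Block (suc N)) → List (Block N)
  dropColᵇ = map dropCol

  removalTerm : Removal (suc N) → 𝔽 p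
  removalTerm (r , bs) = r Fin.zero *F H (dropColᵇ bs)

  removals : List (Block (suc N)) → 𝔽 p
  removals bs = ∑ (decrements bs) removalTerm

  -- Column recursion for H: either no row uses column 0, or column 0 is used
  -- by the first row r of a nonempty block, contributing r[0] times H of the
  -- block list with that block shortened, on the remaining columns.
  column-recursion : (bs : List (Block (suc N))) → H bs ≡ H (dropColᵇ bs) +F removals bs
  column-recursion bs = begin
    H bs
      ≡⟨ H≡expandᴸ bs ⟩
    expandᴸ (rows bs)
      ≡⟨ column-expansion _ (rows bs) refl ⟩
    expandᴸ (map dropCol (rows bs)) +F ∑ (leaders (rows bs)) leaderTerm
      ≡⟨ cong₂ _+F_ (cong expandᴸ (rowsFrom-map (_∘ Fin.suc) 0 bs)) (sym (∑-map (leaders (rows bs)) E φ)) ⟩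
    expandᴸ (rows (dropColᵇ bs)) +F ∑ (map E (leaders (rows bs))) φ
      ≡⟨ cong₂ _+F_ (sym (H≡expandᴸ (dropColᵇ bs))) (cong (λ L → ∑ L φ) (leaders-rows 0 bs)) ⟩
    H (dropColᵇ bs) +F ∑ (map (λ q → proj₁ q , rows (proj₂ q)) (decrements bs)) φ
      ≡⟨ cong (H (dropColᵇ bs) +F_) (∑-map (decrements bs) _ φ) ⟩
    H (dropColᵇ bs) +F ∑ (decrements bs) (λ q → proj₁ q Fin.zero *F expandᴸ (map dropCol (rows (proj₂ q))))
      ≡⟨ cong (H (dropColᵇ bs) +F_) (∑-cong (decrements bs) λ q → cong (proj₁ q Fin.zero *F_) (begin
           expandᴸ (map dropCol (rows (proj₂ q)))  ≡⟨ cong expandᴸ (rowsFrom-map (_∘ Fin.suc) 0 (proj₂ q)) ⟩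
           expandᴸ (rows (dropColᵇ (proj₂ q)))     ≡⟨ H≡expandᴸ (dropColᵇ (proj₂ q)) ⟨
           H (dropColᵇ (proj₂ q))                  ∎)) ⟩
    H (dropColᵇ bs) +F ∑ (decrements bs) removalTerm ∎
    where
    E : Split _ → Removal _
    E q = entry (proj₁ q) , proj₂ q
    φ : Removal _ → 𝔽 p
    φ (r , R) = r Fin.zero *F expandᴸ (map dropCol R)

  S-as-sum : ∀ n (x : 𝔽^ p N) → S n x ≡ ∑ (allSubsets N) (λ T → when (∣ T ∣ ℕ.≟ n) (prodOver T x))
  S-as-sum {N = N} n x = ∑-filter (λ T → ∣ T ∣ ℕ.≟ n) (allSubsets N) (λ T → prodOver T x)

  S-split : ∀ n (x : 𝔽^ p (suc N)) →
    S n x ≡ ∑ (allSubsets N) (λ T → when (suc ∣ T ∣ ℕ.≟ n) (x Fin.zero *F prodOver T (x ∘ Fin.suc))) +F S n (x ∘ Fin.suc)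
  S-split {N = N} n x = begin
    S n x
      ≡⟨ S-as-sum n x ⟩
    ∑ (map (true Vec.∷_) (allSubsets N) ++ map (false Vec.∷_) (allSubsets N)) term
      ≡⟨ ∑-++ (map (true Vec.∷_) (allSubsets N)) _ term ⟩
    ∑ (map (true Vec.∷_) (allSubsets N)) term +F ∑ (map (false Vec.∷_) (allSubsets N)) term
      ≡⟨ cong₂ _+F_ (trans (∑-map (allSubsets N) _ term) (∑-cong (allSubsets N) with-0))
                    (trans (∑-map (allSubsets N) _ term) (trans (∑-cong (allSubsets N) without-0) (sym (S-as-sum n (x ∘ Fin.suc))))) ⟩
    ∑ (allSubsets N) (λ T → when (suc ∣ T ∣ ℕ.≟ n) (x Fin.zero *F prodOver T (x ∘ Fin.suc))) +F S n (x ∘ Fin.suc) ∎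
    where
    term : Subset (suc N) → 𝔽 p
    term T = when (∣ T ∣ ℕ.≟ n) (prodOver T x)
    with-0 : ∀ T → term (true Vec.∷ T) ≡ when (suc ∣ T ∣ ℕ.≟ n) (x Fin.zero *F prodOver T (x ∘ Fin.suc))
    with-0 T = cong (when (suc ∣ T ∣ ℕ.≟ n)) (∏-allFin-suc N (λ i → if Vec.lookup (true Vec.∷ T) i then x i else 1F))
    without-0 : ∀ T → term (false Vec.∷ T) ≡ when (∣ T ∣ ℕ.≟ n) (prodOver T (x ∘ Fin.suc))
    without-0 T = cong (when (∣ T ∣ ℕ.≟ n))
      (trans (∏-allFin-suc N (λ i → if Vec.lookup (false Vec.∷ T) i then x i else 1F)) (*-identityˡ _))

  S-recursion : ∀ n (x : 𝔽^ p (suc N)) → S (suc n) x ≡ x Fin.zero *F S n (x ∘ Fin.suc) +F S (suc n) (x ∘ Fin.suc)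
  S-recursion {N = N} n x = trans (S-split (suc n) x) (cong (_+F S (suc n) (x ∘ Fin.suc)) (begin
    ∑ (allSubsets N) (λ T → when (∣ T ∣ ℕ.≟ n) (x Fin.zero *F prodOver T (x ∘ Fin.suc)))
      ≡⟨ ∑-cong (allSubsets N) (λ T → when-*ˡ (∣ T ∣ ℕ.≟ n) (x Fin.zero) _) ⟨
    ∑ (allSubsets N) (λ T → x Fin.zero *F when (∣ T ∣ ℕ.≟ n) (prodOver T (x ∘ Fin.suc)))
      ≡⟨ ∑-*ˡ (allSubsets N) (x Fin.zero) _ ⟨
    x Fin.zero *F ∑ (allSubsets N) (λ T → when (∣ T ∣ ℕ.≟ n) (prodOver T (x ∘ Fin.suc)))
      ≡⟨ cong (x Fin.zero *F_) (S-as-sum n (x ∘ Fin.suc)) ⟨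
    x Fin.zero *F S n (x ∘ Fin.suc) ∎))

  S₀-recursion : (x : 𝔽^ p (suc N)) → S 0 x ≡ S 0 (x ∘ Fin.suc)
  S₀-recursion {N = N} x = trans (S-split 0 x)
    (trans (cong (_+F S 0 (x ∘ Fin.suc)) (∑-zero (allSubsets N) (λ _ → refl))) (+-identityˡ _))

  -- S_n is H of the single block x^(n): both satisfy the same column recursion.
  S≡H : ∀ n (x : 𝔽^ p N) → S n x ≡ H ((x , n) ∷ [])
  S≡H {N = zero}  zero    x = sym (H≡ℋ ((x , 0) ∷ []))
  S≡H {N = zero}  (suc n) x = sym (H≡ℋ ((x , suc n) ∷ []))
  S≡H {N = suc N} zero    x = begin
    S 0 x                                ≡⟨ S₀-recursion x ⟩
    S 0 x'                               ≡⟨ S≡H 0 x' ⟩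
    H ((x' , 0) ∷ [])                    ≡⟨ +-identityʳ _ ⟨
    H ((x' , 0) ∷ []) +F 0F              ≡⟨ column-recursion ((x , 0) ∷ []) ⟨
    H ((x , 0) ∷ [])                     ∎
    where x' = x ∘ Fin.suc
  S≡H {N = suc N} (suc n) x = begin
    S (suc n) x                                          ≡⟨ S-recursion n x ⟩
    x Fin.zero *F S n x' +F S (suc n) x'                 ≡⟨ cong₂ (λ a b → x Fin.zero *F a +F b) (S≡H n x') (S≡H (suc n) x') ⟩
    x Fin.zero *F H ((x' , n) ∷ []) +F H ((x' , suc n) ∷ [])
      ≡⟨ +-comm (x Fin.zero *F H ((x' , n) ∷ [])) (H ((x' , suc n) ∷ [])) ⟩
    H ((x' , suc n) ∷ []) +F x Fin.zero *F H ((x' , n) ∷ [])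
      ≡⟨ cong (H ((x' , suc n) ∷ []) +F_) (+-identityʳ _) ⟨
    H ((x' , suc n) ∷ []) +F (x Fin.zero *F H ((x' , n) ∷ []) +F 0F)
      ≡⟨ column-recursion ((x , suc n) ∷ []) ⟨
    H ((x , suc n) ∷ [])                                 ∎
    where x' = x ∘ Fin.suc

  H-rows : (bs bs' : List (Block N)) → rows bs ≡ rows bs' → H bs ≡ H bs'
  H-rows bs bs' same = trans (H≡expandᴸ bs) (trans (cong expandᴸ same) (sym (H≡expandᴸ bs')))

  rowsFrom-empty-block : ∀ t (B : List (Block N)) (y : 𝔽^ p N) → rowsFrom t (B ++ (y , 0) ∷ []) ≡ rowsFrom t B
  rowsFrom-empty-block t []             y = refl
  rowsFrom-empty-block t ((r , ℓ) ∷ B) y = cong (List.replicate ℓ (r , t) ++_) (rowsFrom-empty-block (suc t) B y)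

  rowsFrom-nonempty : ∀ t (B : List (Block N)) (y : 𝔽^ p N) ℓ C → List.null (rowsFrom t (B ++ (y , suc ℓ) ∷ C)) ≡ false
  rowsFrom-nonempty t []             y ℓ C = refl
  rowsFrom-nonempty t ((r , zero) ∷ B)  y ℓ C = rowsFrom-nonempty (suc t) B y ℓ C
  rowsFrom-nonempty t ((r , suc _) ∷ B) y ℓ C = refl

  H-no-columns : (bs : List (Block 0)) → H bs ≡ (if List.null (rows bs) then 1F else 0F)
  H-no-columns bs = trans (H≡expandᴸ bs) (no-columns (rows bs))
    where
    no-columns : (R : List (Row 0)) → expandᴸ R ≡ (if List.null R then 1F else 0F)
    no-columns []      = refl
    no-columns (_ ∷ _) = refl

  decrements-++ : (B C : List (Block N)) →
    decrements (B ++ C) ≡ map (λ q → proj₁ q , proj₂ q ++ C) (decrements B) ++ map (λ q → proj₁ q , B ++ proj₂ q) (decrements C)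
  decrements-++ [] C = sym (map-id (decrements C))
  decrements-++ ((r , ℓ) ∷ B) C = begin
    removeFirst (r , ℓ) (B ++ C) ++ map (under (r , ℓ)) (decrements (B ++ C))
      ≡⟨ cong₂ _++_ (first ℓ) (cong (map (under (r , ℓ))) (decrements-++ B C)) ⟩
    map appendC (removeFirst (r , ℓ) B) ++ map (under (r , ℓ)) (map appendC (decrements B) ++ map (prependB B) (decrements C))
      ≡⟨ cong (map appendC (removeFirst (r , ℓ) B) ++_) (map-++ (under (r , ℓ)) (map appendC (decrements B)) (map (prependB B) (decrements C))) ⟩
    map appendC (removeFirst (r , ℓ) B) ++ (map (under (r , ℓ)) (map appendC (decrements B)) ++ map (under (r , ℓ)) (map (prependB B) (decrements C)))
      ≡⟨ cong₂ (λ X Y → map appendC (removeFirst (r , ℓ) B) ++ (X ++ Y))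
               (trans (sym (map-∘ (decrements B))) (map-∘ (decrements B)))
               (sym (map-∘ (decrements C))) ⟩
    map appendC (removeFirst (r , ℓ) B) ++ (map appendC (map (under (r , ℓ)) (decrements B)) ++ map (prependB ((r , ℓ) ∷ B)) (decrements C))
      ≡⟨ ++-assoc (map appendC (removeFirst (r , ℓ) B)) _ _ ⟨
    (map appendC (removeFirst (r , ℓ) B) ++ map appendC (map (under (r , ℓ)) (decrements B))) ++ map (prependB ((r , ℓ) ∷ B)) (decrements C)
      ≡⟨ cong (_++ map (prependB ((r , ℓ) ∷ B)) (decrements C)) (map-++ appendC (removeFirst (r , ℓ) B) _) ⟨
    map appendC (decrements ((r , ℓ) ∷ B)) ++ map (prependB ((r , ℓ) ∷ B)) (decrements C) ∎
    where
    appendC : Removal _ → Removal _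
    appendC q = proj₁ q , proj₂ q ++ C
    prependB : List (Block _) → Removal _ → Removal _
    prependB B' q = proj₁ q , B' ++ proj₂ q
    first : ∀ ℓ → removeFirst (r , ℓ) (B ++ C) ≡ map appendC (removeFirst (r , ℓ) B)
    first zero    = refl
    first (suc ℓ) = refl

  firstRemovals : 𝔽^ p (suc N) → ℕ → List (Block (suc N)) → 𝔽 p
  firstRemovals r ℓ B = ∑ (removeFirst (r , ℓ) B) removalTerm

  removals-cons : (r : 𝔽^ p (suc N)) (ℓ : ℕ) (B : List (Block (suc N))) →
    removals ((r , ℓ) ∷ B) ≡ firstRemovals r ℓ B +F ∑ (decrements B) (removalTerm ∘ under (r , ℓ))
  removals-cons r ℓ B = trans (∑-++ (removeFirst (r , ℓ) B) _ removalTerm)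
                              (cong (firstRemovals r ℓ B +F_) (∑-map (decrements B) (under (r , ℓ)) removalTerm))

  firstRemovals-suc : (r : 𝔽^ p (suc N)) (ℓ : ℕ) (B : List (Block (suc N))) →
    firstRemovals r (suc ℓ) B ≡ r Fin.zero *F H (dropColᵇ ((r , ℓ) ∷ B))
  firstRemovals-suc r ℓ B = +-identityʳ _

  dropColᵇ-++ : (B C : List (Block (suc N))) → dropColᵇ (B ++ C) ≡ dropColᵇ B ++ dropColᵇ C
  dropColᵇ-++ = map-++ dropCol

  -- By induction on the number of columns, using the column recursion: a
  -- row of (x+y) in column 0 contributes x₀ + y₀, i.e. a row of x or of y.
  shift : (x y : 𝔽^ p N) (m : ℕ) (B : List (Block N)) →
    H ((x ⊕ y , m) ∷ B) ≡ ∑< (suc m) (λ j → H ((x , m ∸ j) ∷ B ++ (y , j) ∷ []))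
  shift x y zero B = trans (H-rows ((x ⊕ y , 0) ∷ B) ((x , 0) ∷ B ++ (y , 0) ∷ []) (sym (rowsFrom-empty-block 1 B y)))
                           (sym (+-identityʳ (H ((x , 0) ∷ B ++ (y , 0) ∷ []))))
  shift {N = zero} x y (suc m) B = trans (H-no-columns ((x ⊕ y , suc m) ∷ B)) (sym (begin
    ∑< (suc (suc m)) f        ≡⟨ ∑<-last (suc m) f ⟩
    ∑< (suc m) f +F f (suc m) ≡⟨ cong₂ _+F_ (trans (∑<-cong (suc m) early) (∑-zero (upTo (suc m)) (λ _ → refl))) last ⟩
    0F +F 0F                  ≡⟨ +-identityʳ 0F ⟩
    0F                        ∎))
    where
    f : ℕ → 𝔽 p
    f j = H ((x , suc m ∸ j) ∷ B ++ (y , j) ∷ [])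
    -- with no columns every nonempty M contributes 0
    early : ∀ j → j ℕ.< suc m → f j ≡ 0F
    early j (ℕ.s≤s j≤m) = trans (cong (λ k → H ((x , k) ∷ B ++ (y , j) ∷ [])) (ℕP.+-∸-assoc 1 j≤m))
                                (H-no-columns ((x , suc (m ∸ j)) ∷ B ++ (y , j) ∷ []))
    last : f (suc m) ≡ 0F
    last = trans (cong (λ k → H ((x , k) ∷ B ++ (y , suc m) ∷ [])) (ℕP.n∸n≡0 m))
                 (trans (H-no-columns ((x , 0) ∷ B ++ (y , suc m) ∷ [])) (cong (λ b → if b then 1F else 0F) (rowsFrom-nonempty 1 B y m [])))
  shift {N = suc N} x y (suc m) B = begin
    H ((x ⊕ y , suc m) ∷ B)
      ≡⟨ column-recursion ((x ⊕ y , suc m) ∷ B) ⟩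
    H ((x' ⊕ y' , suc m) ∷ B') +F removals ((x ⊕ y , suc m) ∷ B)
      ≡⟨ cong₂ _+F_ (shift x' y' (suc m) B') (removals-cons (x ⊕ y) (suc m) B) ⟩
    ∑ⱼ A +F (firstRemovals (x ⊕ y) (suc m) B +F ∑ (decrements B) (removalTerm ∘ under (x ⊕ y , suc m)))
      ≡⟨ cong₂ (λ a b → ∑ⱼ A +F (a +F b)) head-split shifted-removals ⟩
    ∑ⱼ A +F ((∑ⱼ hx +F ∑ⱼ hy) +F ∑ⱼ dB)
      ≡⟨ cong (∑ⱼ A +F_) (trans (+-assoc _ _ _) (cong (∑ⱼ hx +F_) (+-comm (∑ⱼ hy) (∑ⱼ dB)))) ⟩
    ∑ⱼ A +F (∑ⱼ hx +F (∑ⱼ dB +F ∑ⱼ hy))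
      ≡⟨ cong (λ s → ∑ⱼ A +F (∑ⱼ hx +F s)) (∑-+ (upTo (suc (suc m))) dB hy) ⟨
    ∑ⱼ A +F (∑ⱼ hx +F ∑ⱼ (λ j → dB j +F hy j))
      ≡⟨ cong (∑ⱼ A +F_) (∑-+ (upTo (suc (suc m))) hx _) ⟨
    ∑ⱼ A +F ∑ⱼ (λ j → hx j +F (dB j +F hy j))
      ≡⟨ ∑-+ (upTo (suc (suc m))) A _ ⟨
    ∑ⱼ (λ j → A j +F (hx j +F (dB j +F hy j)))
      ≡⟨ ∑-cong (upTo (suc (suc m))) term-split ⟨
    ∑ⱼ (λ j → H ((x , suc m ∸ j) ∷ B ++ (y , j) ∷ [])) ∎
    where
    ∑ⱼ : (ℕ → 𝔽 p) → 𝔽 p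
    ∑ⱼ = ∑< (suc (suc m))
    x' y' : 𝔽^ p N
    x' = x ∘ Fin.suc
    y' = y ∘ Fin.suc
    B' = dropColᵇ B
    -- the summands: no row in column 0; a row of x, of B, or of y in column 0
    A hx dB hy : ℕ → 𝔽 p
    A  j = H ((x' , suc m ∸ j) ∷ B' ++ (y' , j) ∷ [])
    hx j = firstRemovals x (suc m ∸ j) (B ++ (y , j) ∷ [])
    dB j = ∑ (decrements B) (λ q → removalTerm (proj₁ q , (x , suc m ∸ j) ∷ proj₂ q ++ (y , j) ∷ []))
    hy j = ∑ (decrements ((y , j) ∷ [])) (λ q → removalTerm (proj₁ q , (x , suc m ∸ j) ∷ B ++ proj₂ q))

    term-split : ∀ j → H ((x , suc m ∸ j) ∷ B ++ (y , j) ∷ []) ≡ A j +F (hx j +F (dB j +F hy j))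
    term-split j = begin
      H ((x , k) ∷ B ++ (y , j) ∷ [])
        ≡⟨ column-recursion ((x , k) ∷ B ++ (y , j) ∷ []) ⟩
      H ((x' , k) ∷ dropColᵇ (B ++ (y , j) ∷ [])) +F removals ((x , k) ∷ B ++ (y , j) ∷ [])
        ≡⟨ cong₂ _+F_ (cong (λ C → H ((x' , k) ∷ C)) (dropColᵇ-++ B ((y , j) ∷ [])))
                      (removals-cons x k (B ++ (y , j) ∷ [])) ⟩
      A j +F (hx j +F ∑ (decrements (B ++ (y , j) ∷ [])) (removalTerm ∘ under (x , k)))
        ≡⟨ cong (λ L → A j +F (hx j +F ∑ L (removalTerm ∘ under (x , k)))) (decrements-++ B ((y , j) ∷ [])) ⟩
      A j +F (hx j +F ∑ (map _ (decrements B) ++ map _ (decrements ((y , j) ∷ []))) (removalTerm ∘ under (x , k)))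
        ≡⟨ cong (λ s → A j +F (hx j +F s)) (trans (∑-++ (map _ (decrements B)) _ _)
                 (cong₂ _+F_ (∑-map (decrements B) _ _) (∑-map (decrements ((y , j) ∷ [])) _ _))) ⟩
      A j +F (hx j +F (dB j +F hy j)) ∎
      where k = suc m ∸ j

    -- each removal from B is shifted by the induction hypothesis on fewer columns
    shifted-removals : ∑ (decrements B) (removalTerm ∘ under (x ⊕ y , suc m)) ≡ ∑< (suc (suc m)) dB
    shifted-removals = begin
      ∑ (decrements B) (removalTerm ∘ under (x ⊕ y , suc m))
        ≡⟨ ∑-cong (decrements B) (λ q → begin
             proj₁ q Fin.zero *F H ((x' ⊕ y' , suc m) ∷ dropColᵇ (proj₂ q))
               ≡⟨ cong (proj₁ q Fin.zero *F_) (shift x' y' (suc m) (dropColᵇ (proj₂ q))) ⟩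
             proj₁ q Fin.zero *F ∑< (suc (suc m)) (λ j → H ((x' , suc m ∸ j) ∷ dropColᵇ (proj₂ q) ++ (y' , j) ∷ []))
               ≡⟨ ∑-*ˡ (upTo (suc (suc m))) (proj₁ q Fin.zero) _ ⟩
             ∑< (suc (suc m)) (λ j → proj₁ q Fin.zero *F H ((x' , suc m ∸ j) ∷ dropColᵇ (proj₂ q) ++ (y' , j) ∷ []))
               ≡⟨ ∑-cong (upTo (suc (suc m))) (λ j → cong (λ C → proj₁ q Fin.zero *F H ((x' , suc m ∸ j) ∷ C))
                                                         (dropColᵇ-++ (proj₂ q) ((y , j) ∷ []))) ⟨
             ∑< (suc (suc m)) (λ j → removalTerm (proj₁ q , (x , suc m ∸ j) ∷ proj₂ q ++ (y , j) ∷ [])) ∎) ⟩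
      ∑ (decrements B) (λ q → ∑< (suc (suc m)) (λ j → removalTerm (proj₁ q , (x , suc m ∸ j) ∷ proj₂ q ++ (y , j) ∷ [])))
        ≡⟨ ∑-swap (decrements B) (upTo (suc (suc m))) _ ⟩
      ∑< (suc (suc m)) dB ∎

    -- a row of x ⊕ y in column 0 is a row of x or a row of y there
    K : ℕ → 𝔽 p
    K j = H ((x' , m ∸ j) ∷ B' ++ (y' , j) ∷ [])
    hx-early : ∀ j → j ℕ.< suc m → hx j ≡ x Fin.zero *F K j
    hx-early j (ℕ.s≤s j≤m) = begin
      hx j                                    ≡⟨ cong (λ k → firstRemovals x k (B ++ (y , j) ∷ [])) (ℕP.+-∸-assoc 1 j≤m) ⟩
      firstRemovals x (suc (m ∸ j)) (B ++ (y , j) ∷ []) ≡⟨ firstRemovals-suc x (m ∸ j) (B ++ (y , j) ∷ []) ⟩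
      x Fin.zero *F H ((x' , m ∸ j) ∷ dropColᵇ (B ++ (y , j) ∷ []))
        ≡⟨ cong (λ C → x Fin.zero *F H ((x' , m ∸ j) ∷ C)) (dropColᵇ-++ B ((y , j) ∷ [])) ⟩
      x Fin.zero *F K j                       ∎
    hx-last : hx (suc m) ≡ 0F
    hx-last = cong (λ k → firstRemovals x k (B ++ (y , suc m) ∷ [])) (ℕP.n∸n≡0 m)
    hy-later : ∀ j → hy (suc j) ≡ y Fin.zero *F K j
    hy-later j = trans (+-identityʳ _) (cong (λ C → y Fin.zero *F H ((x' , m ∸ j) ∷ C)) (dropColᵇ-++ B ((y , j) ∷ [])))

    head-split : firstRemovals (x ⊕ y) (suc m) B ≡ ∑< (suc (suc m)) hx +F ∑< (suc (suc m)) hy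
    head-split = sym (begin
      ∑< (suc (suc m)) hx +F ∑< (suc (suc m)) hy
        ≡⟨ cong₂ _+F_ (∑<-last (suc m) hx) (∑<-suc (suc m) hy) ⟩
      (∑< (suc m) hx +F hx (suc m)) +F (0F +F ∑< (suc m) (hy ∘ suc))
        ≡⟨ cong₂ _+F_ (trans (cong (∑< (suc m) hx +F_) hx-last) (+-identityʳ _)) (+-identityˡ _) ⟩
      ∑< (suc m) hx +F ∑< (suc m) (hy ∘ suc)
        ≡⟨ cong₂ _+F_ (trans (∑<-cong (suc m) hx-early) (sym (∑-*ˡ (upTo (suc m)) (x Fin.zero) K)))
                      (trans (∑-cong (upTo (suc m)) hy-later) (sym (∑-*ˡ (upTo (suc m)) (y Fin.zero) K))) ⟩
      x Fin.zero *F ∑< (suc m) K +F y Fin.zero *F ∑< (suc m) K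
        ≡⟨ distribʳ (∑< (suc m) K) (x Fin.zero) (y Fin.zero) ⟨
      (x Fin.zero +F y Fin.zero) *F ∑< (suc m) K
        ≡⟨ cong ((x Fin.zero +F y Fin.zero) *F_) (shift x' y' m B') ⟨
      (x Fin.zero +F y Fin.zero) *F H ((x' ⊕ y' , m) ∷ B')
        ≡⟨ firstRemovals-suc (x ⊕ y) m B ⟨
      firstRemovals (x ⊕ y) (suc m) B ∎)

  Δs-cong : ∀ {k} (ys : Vec (𝔽^ p N) k) {f g : 𝔽^ p N → 𝔽 p} → (∀ x → f x ≡ g x) → ∀ x → Δs ys f x ≡ Δs ys g x
  Δs-cong Vec.[]       f≗g x = f≗g x
  Δs-cong (y Vec.∷ ys) f≗g x = Δs-cong ys (λ x' → cong₂ _-F_ (f≗g (x' ⊕ y)) (f≗g x')) x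

  Δs-∑ : ∀ {k} (ys : Vec (𝔽^ p N) k) {I : Set} (L : List I) (h : I → 𝔽^ p N → 𝔽 p) (x : 𝔽^ p N) →
         Δs ys (λ x' → ∑ L (λ a → h a x')) x ≡ ∑ L (λ a → Δs ys (h a) x)
  Δs-∑ Vec.[]       L h x = refl
  Δs-∑ (y Vec.∷ ys) L h x =
    trans (Δs-cong ys (λ x' → ∑-sub L (λ a → h a (x' ⊕ y)) (λ a → h a x')) x) (Δs-∑ ys L (λ a → Δ y (h a)) x)

  -- One derivative in direction y moves a ≥ 1 rows from the x-block to a new y-block
  -- (the term a = 0 of the shift identity is H itself and cancels).
  Δ-block : (y : 𝔽^ p N) (m : ℕ) (B : List (Block N)) (x : 𝔽^ p N) →
    Δ y (λ x' → H ((x' , m) ∷ B)) x ≡ ∑< m (λ a → H ((x , m ∸ suc a) ∷ B ++ (y , suc a) ∷ []))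
  Δ-block y m B x = begin
    H ((x ⊕ y , m) ∷ B) -F H ((x , m) ∷ B)
      ≡⟨ cong (_-F H ((x , m) ∷ B)) (trans (shift x y m B) (∑<-suc m f)) ⟩
    (f 0 +F ∑< m (f ∘ suc)) -F H ((x , m) ∷ B)
      ≡⟨ cong (λ a → (a +F ∑< m (f ∘ suc)) -F H ((x , m) ∷ B))
              (H-rows ((x , m) ∷ B ++ (y , 0) ∷ []) ((x , m) ∷ B) (rowsFrom-empty-block 0 ((x , m) ∷ B) y)) ⟩
    (H ((x , m) ∷ B) +F ∑< m (f ∘ suc)) -F H ((x , m) ∷ B)
      ≡⟨ xyx⁻¹≈y (H ((x , m) ∷ B)) (∑< m (f ∘ suc)) ⟩
    ∑< m (f ∘ suc) ∎
    where
    f : ℕ → 𝔽 p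
    f j = H ((x , m ∸ j) ∷ B ++ (y , j) ∷ [])

  zipBlocks : ∀ {k} → Vec (𝔽^ p N) k → Vec ℕ k → List (Block N)
  zipBlocks ys ℓs = Vec.toList (Vec.zipWith _,_ ys ℓs)

  Δs-block : ∀ {k} (ys : Vec (𝔽^ p N) k) (m : ℕ) (B : List (Block N)) (x : 𝔽^ p N) →
    Δs ys (λ x' → H ((x' , m) ∷ B)) x ≡ ∑parts k m (λ ℓs r → H ((x , r) ∷ B ++ zipBlocks ys ℓs))
  Δs-block Vec.[] m B x = cong (λ C → H ((x , m) ∷ C)) (sym (++-identityʳ B))
  Δs-block {k = suc k} (y Vec.∷ ys) m B x = begin
    Δs ys (Δ y (λ x' → H ((x' , m) ∷ B))) x
      ≡⟨ Δs-cong ys (Δ-block y m B) x ⟩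
    Δs ys (λ x' → ∑< m (λ a → H ((x' , m ∸ suc a) ∷ B ++ (y , suc a) ∷ []))) x
      ≡⟨ Δs-∑ ys (upTo m) (λ a x' → H ((x' , m ∸ suc a) ∷ B ++ (y , suc a) ∷ [])) x ⟩
    ∑< m (λ a → Δs ys (λ x' → H ((x' , m ∸ suc a) ∷ B ++ (y , suc a) ∷ [])) x)
      ≡⟨ ∑-cong (upTo m) (λ a → trans (Δs-block ys (m ∸ suc a) (B ++ (y , suc a) ∷ []) x)
           (∑parts-cong k (m ∸ suc a) (λ ℓs r →
              cong (λ C → H ((x , r) ∷ C)) (++-assoc B ((y , suc a) ∷ []) (zipBlocks ys ℓs))))) ⟩
    ∑parts (suc k) m (λ ℓs r → H ((x , r) ∷ B ++ zipBlocks (y Vec.∷ ys) ℓs)) ∎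

proposition2p2 : (p : ℕ) .{{_ : NonZero p}} → Prime p →
    (N n k : ℕ) → k ≤ n → n ≤ N →
    (ys : Vec (𝔽^ p N) k) → (x : 𝔽^ p N) →
    Δs ys (S n) x ≡ RHS n ys x
proposition2p2 p _ N n k k≤n _ ys x = begin
  Δs ys (S n) x                                       ≡⟨ Δs-cong ys (λ x' → S≡H n x') x ⟩
  Δs ys (λ x' → H ((x' , n) ∷ [])) x                   ≡⟨ Δs-block ys n [] x ⟩
  ∑parts k n (λ ℓs m → H ((x , m) ∷ zipBlocks ys ℓs))  ≡⟨ ∑-compositions≡∑parts k n _ k≤n ⟨
  ∑< (suc (n ∸ k)) (λ m → ∑ (compositions k (n ∸ m)) (λ ℓs → H ((x , m) ∷ zipBlocks ys ℓs)))
    ≡⟨ ∑-cong (upTo (suc (n ∸ k))) (λ m → ∑-cong (compositions k (n ∸ m)) (λ ℓs → H≡ℋ ((x , m) ∷ zipBlocks ys ℓs))) ⟩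
  RHS n ys x                                          ∎
  where open FiniteSums (𝔽-isCommutativeRing {p})
        open CompositionSums (𝔽-isCommutativeRing {p})
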